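{- For every $n\in\mathbb{N}$ the following polynomial identity holds: \[ \prod_{\substack{a=1\\ (a,n)=1}}^{n}\left(x^{(a-1,n)}-1\right)=\prod_{d\mid n}\Phi_d(x)^{\varphi(n)/\varphi(d)}, \] where $\Phi_d(x)$ is the $d$-th cyclotomic polynomial.
   Context: $(x,y)$ denotes the greatest common divisor (with $(0,n)=n$) and $\varphi$ is Euler's totient function. -}

module Defs where

open import Data.Nat as ℕ using (ℕ; zero; suc; _∸_; _<ᵇ_)
open import Data.Nat.DivMod using (_/_)
open import Data.Nat.GCD using (gcd)
open import Data.Nat.Divisibility using (_∣?_)
open import Data.Integer as ℤ using (ℤ; +_)
open import Data.Bool using (if_then_else_)
open import Data.List using (List; []; _∷_; _++_; map; foldr; filter; length; applyUpTo; reverse)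
open import Relation.Binary.PropositionalEquality using (_≡_)

-- Polynomials over ℤ as coefficient lists, lowest degree first.
-- Two polynomials are equal iff all their coefficients agree
-- (trailing zeros are irrelevant).

Poly : Set
Poly = List ℤ

coeff : Poly → ℕ → ℤ
coeff []       _       = + 0
coeff (a ∷ p)  zero    = a
coeff (a ∷ p)  (suc k) = coeff p k

infix 4 _≈ₚ_
_≈ₚ_ : Poly → Poly → Set
p ≈ₚ q = ∀ k → coeff p k ≡ coeff q k

infixl 6 _+ₚ_ _-ₚ_
infixl 7 _*ₚ_

_+ₚ_ : Poly → Poly → Poly
[]      +ₚ q       = q
(a ∷ p) +ₚ []      = a ∷ p
(a ∷ p) +ₚ (b ∷ q) = (a ℤ.+ b) ∷ (p +ₚ q)

negₚ : Poly → Poly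
negₚ = map (ℤ.-_)

_-ₚ_ : Poly → Poly → Poly
p -ₚ q = p +ₚ negₚ q

_*ₚ_ : Poly → Poly → Poly
[]      *ₚ q = []
(a ∷ p) *ₚ q = map (a ℤ.*_) q +ₚ (+ 0 ∷ (p *ₚ q))

oneₚ : Poly
oneₚ = + 1 ∷ []

monomial : ℕ → ℤ → Poly
monomial zero    c = c ∷ []
monomial (suc k) c = + 0 ∷ monomial k c

xpow-1 : ℕ → Poly
xpow-1 k = monomial k (+ 1) -ₚ oneₚ

_^ₚ_ : Poly → ℕ → Poly
p ^ₚ zero  = oneₚ
p ^ₚ suc k = p *ₚ (p ^ₚ k)

prodₚ : List Poly → Poly
prodₚ = foldr _*ₚ_ oneₚ

private
  dropZeros : List ℤ → List ℤ
  dropZeros []          = []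
  dropZeros (+ 0 ∷ xs)  = dropZeros xs
  dropZeros xs@(_ ∷ _)  = xs

  lastOr0 : List ℤ → ℤ
  lastOr0 []           = + 0
  lastOr0 (x ∷ [])     = x
  lastOr0 (_ ∷ y ∷ ys) = lastOr0 (y ∷ ys)

trimₚ : Poly → Poly
trimₚ p = reverse (dropZeros (reverse p))

-- quotient of p by q (q assumed monic), with fuel
divMonicFuel : ℕ → Poly → Poly → Poly
divMonicFuel zero    p q = []
divMonicFuel (suc f) p q =
  let p' = trimₚ p ; q' = trimₚ q in
  if length p' <ᵇ length q' then []
  else (let t = monomial (length p' ∸ length q') (lastOr0 p')
        in t +ₚ divMonicFuel f (p' -ₚ t *ₚ q') q')

divMonic : Poly → Poly → Poly
divMonic p q = divMonicFuel (suc (length p)) p q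

-- Cyclotomic polynomials, by the standard recursive definition
--   Φ_n = (x^n - 1) / ∏_{d ∣ n, d < n} Φ_d      (n ≥ 1).

range1 : ℕ → List ℕ
range1 n = applyUpTo suc n

nthₚ : List Poly → ℕ → Poly
nthₚ []       _       = oneₚ
nthₚ (p ∷ ps) zero    = p
nthₚ (p ∷ ps) (suc k) = nthₚ ps k

-- cycloTable n = [Φ_1, ..., Φ_n]
cycloTable : ℕ → List Poly
cycloTable zero    = []
cycloTable (suc n) =
  let T = cycloTable n in
  T ++ (divMonic (xpow-1 (suc n))
          (prodₚ (map (λ d → nthₚ T (d ∸ 1))
                      (filter (λ d → d ∣? suc n) (range1 n))))
        ∷ [])

-- Φ d, the d-th cyclotomic polynomial (d ≥ 1; Φ 0 is a junk value)
Φ : ℕ → Poly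
Φ d = nthₚ (cycloTable d) (d ∸ 1)

φ : ℕ → ℕ
φ n = length (filter (λ a → gcd a n ℕ.≟ 1) (range1 n))

-- natural-number division, with junk value 0 for division by 0
-- (only used with nonzero divisor φ d, d ≥ 1)
_div_ : ℕ → ℕ → ℕ
m div zero  = 0
m div suc k = m / suc k

-- Since x^m - 1 = ∏_{d ∣ m} Φ_d, the left-hand side is ∏_{d ∣ n} Φ_d^{N_d},
-- where N_d counts the units a modulo n with a ≡ 1 (mod d).  Reduction modulo
-- d maps the units modulo n onto the units modulo d, and multiplying by a unit
-- moves one fibre onto another, so all fibres have N_d elements and
-- N_d = φ(n)/φ(d).  The factorisation of x^m - 1 is proved by strong induction
-- on m: the Φ_d with d a proper divisor of m are monic and pairwise coprime
-- over ℚ, so their product divides x^m - 1, and the long division defining Φ_m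
-- is exact.

module Submission where

open import Defs
open import Data.Nat using (ℕ; _≤_; _∸_)
open import Data.Nat.GCD using (gcd)
open import Data.Nat.Divisibility using (_∣?_)
open import Data.Nat.Properties using (_≟_)
open import Data.List using (map; filter)

module PolyRing where

  open import Data.Nat using (zero; suc)
  open import Data.Integer as ℤ using (ℤ; +_; _+_; _*_; -_; _-_)
  import Data.Integer.Properties as ℤ
  open import Data.Integer.Solver using (module +-*-Solver)
  open import Data.List using (map; []; _∷_)
  open import Data.Maybe using (Maybe; just; nothing)
  open import Data.Product using (_,_)
  open import Relation.Binary.PropositionalEquality
  open import Relation.Nullary using (yes; no)
  open import Algebra.Bundles using (CommutativeRing)
  open import Algebra.Structures using (IsCommutativeRing)
  open import Algebra.Solver.Ring.AlmostCommutativeRing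
    using (AlmostCommutativeRing; fromCommutativeRing; _-Raw-AlmostCommutative⟶_)
  import Algebra.Solver.Ring

  coeff-+ₚ : ∀ p q k → coeff (p +ₚ q) k ≡ coeff p k + coeff q k
  coeff-+ₚ []      q       k       = sym (ℤ.+-identityˡ _)
  coeff-+ₚ (a ∷ p) []      k       = sym (ℤ.+-identityʳ _)
  coeff-+ₚ (a ∷ p) (b ∷ q) zero    = refl
  coeff-+ₚ (a ∷ p) (b ∷ q) (suc k) = coeff-+ₚ p q k

  coeff-map : ∀ (f : ℤ → ℤ) → f (+ 0) ≡ + 0 → ∀ p k → coeff (map f p) k ≡ f (coeff p k)
  coeff-map f f0 []      k       = sym f0
  coeff-map f f0 (a ∷ p) zero    = refl
  coeff-map f f0 (a ∷ p) (suc k) = coeff-map f f0 p k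

  coeff-negₚ : ∀ p k → coeff (negₚ p) k ≡ - coeff p k
  coeff-negₚ = coeff-map -_ refl

  coeff-scale : ∀ a p k → coeff (map (a *_) p) k ≡ a * coeff p k
  coeff-scale a = coeff-map (a *_) (ℤ.*-zeroʳ a)

  coeff--ₚ : ∀ p q k → coeff (p -ₚ q) k ≡ coeff p k - coeff q k
  coeff--ₚ p q k = trans (coeff-+ₚ p (negₚ q) k) (cong (_+_ (coeff p k)) (coeff-negₚ q k))

  -- _≈ₚ_ is a function type, from which Agda cannot infer the two polynomials;
  -- the record wrapper makes them inferable.
  infix 4 _≋_
  record _≋_ (p q : Poly) : Set where
    constructor mk≋
    field coeff-≡ : p ≈ₚ q
  open _≋_ public

  ≋-refl : ∀ {p} → p ≋ p
  ≋-refl = mk≋ λ k → refl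

  ≋-sym : ∀ {p q} → p ≋ q → q ≋ p
  ≋-sym (mk≋ e) = mk≋ λ k → sym (e k)

  ≋-trans : ∀ {p q r} → p ≋ q → q ≋ r → p ≋ r
  ≋-trans (mk≋ e) (mk≋ f) = mk≋ λ k → trans (e k) (f k)

  ≡⇒≋ : ∀ {p q} → p ≡ q → p ≋ q
  ≡⇒≋ refl = ≋-refl

  ∷-cong : ∀ {a b p q} → a ≡ b → p ≋ q → (a ∷ p) ≋ (b ∷ q)
  ∷-cong a≡b (mk≋ e) = mk≋ λ { zero → a≡b ; (suc k) → e k }

  0∷-cong : ∀ {p q} → p ≋ q → (+ 0 ∷ p) ≋ (+ 0 ∷ q)
  0∷-cong = ∷-cong refl

  +ₚ-cong : ∀ {p p′ q q′} → p ≋ p′ → q ≋ q′ → p +ₚ q ≋ p′ +ₚ q′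
  +ₚ-cong {p} {p′} {q} {q′} (mk≋ e) (mk≋ f) = mk≋ λ k →
    trans (coeff-+ₚ p q k) (trans (cong₂ _+_ (e k) (f k)) (sym (coeff-+ₚ p′ q′ k)))

  negₚ-cong : ∀ {p q} → p ≋ q → negₚ p ≋ negₚ q
  negₚ-cong {p} {q} (mk≋ e) = mk≋ λ k →
    trans (coeff-negₚ p k) (trans (cong -_ (e k)) (sym (coeff-negₚ q k)))

  scale-cong : ∀ a {p q} → p ≋ q → map (a *_) p ≋ map (a *_) q
  scale-cong a {p} {q} (mk≋ e) = mk≋ λ k →
    trans (coeff-scale a p k) (trans (cong (a *_) (e k)) (sym (coeff-scale a q k)))

  +ₚ-comm : ∀ p q → p +ₚ q ≋ q +ₚ p
  +ₚ-comm p q = mk≋ λ k →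
    trans (coeff-+ₚ p q k) (trans (ℤ.+-comm (coeff p k) (coeff q k)) (sym (coeff-+ₚ q p k)))

  +ₚ-assoc : ∀ p q r → (p +ₚ q) +ₚ r ≋ p +ₚ (q +ₚ r)
  +ₚ-assoc p q r = mk≋ λ k → begin
    coeff ((p +ₚ q) +ₚ r) k             ≡⟨ coeff-+ₚ (p +ₚ q) r k ⟩
    coeff (p +ₚ q) k + coeff r k        ≡⟨ cong (_+ coeff r k) (coeff-+ₚ p q k) ⟩
    coeff p k + coeff q k + coeff r k   ≡⟨ ℤ.+-assoc (coeff p k) (coeff q k) (coeff r k) ⟩
    coeff p k + (coeff q k + coeff r k) ≡⟨ cong (_+_ (coeff p k)) (coeff-+ₚ q r k) ⟨
    coeff p k + coeff (q +ₚ r) k        ≡⟨ coeff-+ₚ p (q +ₚ r) k ⟨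
    coeff (p +ₚ (q +ₚ r)) k             ∎
    where open ≡-Reasoning

  +ₚ-identityʳ : ∀ p → p +ₚ [] ≋ p
  +ₚ-identityʳ []      = ≋-refl
  +ₚ-identityʳ (a ∷ p) = ≋-refl

  -ₚ-self : ∀ p → p -ₚ p ≋ []
  -ₚ-self p = mk≋ λ k → trans (coeff--ₚ p p k) (ℤ.+-inverseʳ (coeff p k))

  *ₚ-zeroʳ : ∀ p → p *ₚ [] ≋ []
  *ₚ-zeroʳ []      = ≋-refl
  *ₚ-zeroʳ (a ∷ p) = mk≋ λ { zero → refl ; (suc k) → coeff-≡ (*ₚ-zeroʳ p) k }

  ≋[]⇒*ₚ≋[] : ∀ {p} q → p ≋ [] → p *ₚ q ≋ []
  ≋[]⇒*ₚ≋[] {[]}    q _       = ≋-refl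
  ≋[]⇒*ₚ≋[] {a ∷ p} q (mk≋ z) =
    ≋-trans (+ₚ-cong scaled-by-0 (0∷-cong tail)) (mk≋ λ { zero → refl ; (suc k) → refl })
    where
    scaled-by-0 : map (a *_) q ≋ []
    scaled-by-0 = mk≋ λ k → trans (coeff-scale a q k) (cong (_* coeff q k) (z zero))
    tail : p *ₚ q ≋ []
    tail = ≋[]⇒*ₚ≋[] {p} q (mk≋ λ k → z (suc k))

  *ₚ-congʳ : ∀ {p p′} q → p ≋ p′ → p *ₚ q ≋ p′ *ₚ q
  *ₚ-congʳ {[]}    q e = ≋-sym (≋[]⇒*ₚ≋[] q (≋-sym e))
  *ₚ-congʳ {a ∷ p} {[]} q e = ≋[]⇒*ₚ≋[] q e
  *ₚ-congʳ {a ∷ p} {b ∷ p′} q (mk≋ e) =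
    +ₚ-cong (≡⇒≋ (cong (λ c → map (c *_) q) (e zero)))
            (0∷-cong (*ₚ-congʳ {p} {p′} q (mk≋ λ k → e (suc k))))

  *ₚ-congˡ : ∀ p {q q′} → q ≋ q′ → p *ₚ q ≋ p *ₚ q′
  *ₚ-congˡ []      e = ≋-refl
  *ₚ-congˡ (a ∷ p) e = +ₚ-cong (scale-cong a e) (0∷-cong (*ₚ-congˡ p e))

  *ₚ-cong : ∀ {p p′ q q′} → p ≋ p′ → q ≋ q′ → p *ₚ q ≋ p′ *ₚ q′
  *ₚ-cong {p′ = p′} {q = q} e f = ≋-trans (*ₚ-congʳ q e) (*ₚ-congˡ p′ f)

  module _ where
    open +-*-Solver

    *ₚ-∷ʳ : ∀ p a q → p *ₚ (a ∷ q) ≋ map (a *_) p +ₚ (+ 0 ∷ (p *ₚ q))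
    *ₚ-∷ʳ p a q = mk≋ (go p)
      where
      go : ∀ p k → coeff (p *ₚ (a ∷ q)) k ≡ coeff (map (a *_) p +ₚ (+ 0 ∷ (p *ₚ q))) k
      go []      zero    = refl
      go []      (suc k) = refl
      go (b ∷ p) zero    = cong (_+ _) (ℤ.*-comm b a)
      go (b ∷ p) (suc k) = begin
        coeff (bq +ₚ p *ₚ (a ∷ q)) k
          ≡⟨ coeff-+ₚ bq _ k ⟩
        B + coeff (p *ₚ (a ∷ q)) k
          ≡⟨ cong (_+_ B) (go p k) ⟩
        B + coeff (map (a *_) p +ₚ (+ 0 ∷ (p *ₚ q))) k
          ≡⟨ cong (_+_ B) (coeff-+ₚ (map (a *_) p) _ k) ⟩
        B + (A + W)
          ≡⟨ solve 3 (λ b a w → b :+ (a :+ w) := a :+ (b :+ w)) refl B A W ⟩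
        A + (B + W)
          ≡⟨ cong (_+_ A) (coeff-+ₚ bq (+ 0 ∷ (p *ₚ q)) k) ⟨
        A + coeff (bq +ₚ (+ 0 ∷ (p *ₚ q))) k
          ≡⟨ coeff-+ₚ (map (a *_) p) _ k ⟨
        coeff (map (a *_) p +ₚ (bq +ₚ (+ 0 ∷ (p *ₚ q)))) k ∎
        where
        open ≡-Reasoning
        bq = map (b *_) q
        A = coeff (map (a *_) p) k
        B = coeff bq k
        W = coeff (+ 0 ∷ (p *ₚ q)) k

    +ₚ-interchange : ∀ a b c d → (a +ₚ b) +ₚ (c +ₚ d) ≋ (a +ₚ c) +ₚ (b +ₚ d)
    +ₚ-interchange a b c d = mk≋ λ k → begin
      coeff ((a +ₚ b) +ₚ (c +ₚ d)) k
        ≡⟨ coeff-+ₚ (a +ₚ b) _ k ⟩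
      coeff (a +ₚ b) k + coeff (c +ₚ d) k
        ≡⟨ cong₂ _+_ (coeff-+ₚ a b k) (coeff-+ₚ c d k) ⟩
      (A k + B k) + (C k + D k)
        ≡⟨ solve 4 (λ a b c d → (a :+ b) :+ (c :+ d) := (a :+ c) :+ (b :+ d)) refl (A k) (B k) (C k) (D k) ⟩
      (A k + C k) + (B k + D k)
        ≡⟨ cong₂ _+_ (coeff-+ₚ a c k) (coeff-+ₚ b d k) ⟨
      coeff (a +ₚ c) k + coeff (b +ₚ d) k
        ≡⟨ coeff-+ₚ (a +ₚ c) _ k ⟨
      coeff ((a +ₚ c) +ₚ (b +ₚ d)) k ∎
      where
      open ≡-Reasoning
      A = coeff a ; B = coeff b ; C = coeff c ; D = coeff d

  scale-+ₚ : ∀ a p q → map (a *_) (p +ₚ q) ≋ map (a *_) p +ₚ map (a *_) q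
  scale-+ₚ a p q = mk≋ λ k → begin
    coeff (map (a *_) (p +ₚ q)) k                ≡⟨ coeff-scale a (p +ₚ q) k ⟩
    a * coeff (p +ₚ q) k                         ≡⟨ cong (a *_) (coeff-+ₚ p q k) ⟩
    a * (coeff p k + coeff q k)                  ≡⟨ ℤ.*-distribˡ-+ a (coeff p k) (coeff q k) ⟩
    a * coeff p k + a * coeff q k                ≡⟨ cong₂ _+_ (coeff-scale a p k) (coeff-scale a q k) ⟨
    coeff (map (a *_) p) k + coeff (map (a *_) q) k ≡⟨ coeff-+ₚ (map (a *_) p) _ k ⟨
    coeff (map (a *_) p +ₚ map (a *_) q) k       ∎
    where open ≡-Reasoning

  scale-scale : ∀ a b p → map (a *_) (map (b *_) p) ≋ map ((a * b) *_) p
  scale-scale a b p = mk≋ λ k →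
    trans (coeff-scale a (map (b *_) p) k) (trans (cong (a *_) (coeff-scale b p k))
    (trans (sym (ℤ.*-assoc a b (coeff p k))) (sym (coeff-scale (a * b) p k))))

  scale-one : ∀ p → map (+ 1 *_) p ≋ p
  scale-one p = mk≋ λ k → trans (coeff-scale (+ 1) p k) (ℤ.*-identityˡ (coeff p k))

  *ₚ-comm : ∀ p q → p *ₚ q ≋ q *ₚ p
  *ₚ-comm []      q = ≋-sym (*ₚ-zeroʳ q)
  *ₚ-comm (a ∷ p) q = ≋-sym (≋-trans (*ₚ-∷ʳ q a p) (+ₚ-cong ≋-refl (0∷-cong (*ₚ-comm q p))))

  *ₚ-distribˡ-+ₚ : ∀ p q r → p *ₚ (q +ₚ r) ≋ p *ₚ q +ₚ p *ₚ r
  *ₚ-distribˡ-+ₚ []      q r = ≋-refl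
  *ₚ-distribˡ-+ₚ (a ∷ p) q r =
    ≋-trans (+ₚ-cong (scale-+ₚ a q r) (0∷-cong (*ₚ-distribˡ-+ₚ p q r)))
            (+ₚ-interchange (map (a *_) q) (map (a *_) r) (+ 0 ∷ (p *ₚ q)) (+ 0 ∷ (p *ₚ r)))

  *ₚ-distribʳ-+ₚ : ∀ p q r → (q +ₚ r) *ₚ p ≋ q *ₚ p +ₚ r *ₚ p
  *ₚ-distribʳ-+ₚ p q r =
    ≋-trans (*ₚ-comm (q +ₚ r) p) (≋-trans (*ₚ-distribˡ-+ₚ p q r) (+ₚ-cong (*ₚ-comm p q) (*ₚ-comm p r)))

  scale-*ₚ : ∀ a p q → map (a *_) p *ₚ q ≋ map (a *_) (p *ₚ q)
  scale-*ₚ a []      q = ≋-refl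
  scale-*ₚ a (b ∷ p) q =
    ≋-trans (+ₚ-cong (≋-sym (scale-scale a b q)) (0∷-cong (scale-*ₚ a p q)))
            (≋-sym (≋-trans (scale-+ₚ a (map (b *_) q) (+ 0 ∷ (p *ₚ q)))
                            (+ₚ-cong ≋-refl (∷-cong (ℤ.*-zeroʳ a) ≋-refl))))

  0∷-*ₚ : ∀ p q → (+ 0 ∷ p) *ₚ q ≋ + 0 ∷ (p *ₚ q)
  0∷-*ₚ p q = +ₚ-cong {map (+ 0 *_) q} {[]} (mk≋ λ k → coeff-scale (+ 0) q k) ≋-refl

  *ₚ-assoc : ∀ p q r → (p *ₚ q) *ₚ r ≋ p *ₚ (q *ₚ r)
  *ₚ-assoc []      q r = ≋-refl
  *ₚ-assoc (a ∷ p) q r =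
    ≋-trans (*ₚ-distribʳ-+ₚ r (map (a *_) q) (+ 0 ∷ (p *ₚ q)))
            (+ₚ-cong (scale-*ₚ a q r) (≋-trans (0∷-*ₚ (p *ₚ q) r) (0∷-cong (*ₚ-assoc p q r))))

  *ₚ-identityˡ : ∀ p → oneₚ *ₚ p ≋ p
  *ₚ-identityˡ p = ≋-trans (+ₚ-cong (scale-one p) (mk≋ λ { zero → refl ; (suc k) → refl })) (+ₚ-identityʳ p)

  *ₚ-identityʳ : ∀ p → p *ₚ oneₚ ≋ p
  *ₚ-identityʳ p = ≋-trans (*ₚ-comm p oneₚ) (*ₚ-identityˡ p)

  isCommutativeRing : IsCommutativeRing _≋_ _+ₚ_ _*ₚ_ negₚ [] oneₚ
  isCommutativeRing = record
    { isRing = record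
      { +-isAbelianGroup = record
        { isGroup = record
          { isMonoid = record
            { isSemigroup = record
              { isMagma = record
                { isEquivalence = record { refl = ≋-refl ; sym = ≋-sym ; trans = ≋-trans }
                ; ∙-cong = +ₚ-cong }
              ; assoc = +ₚ-assoc }
            ; identity = (λ p → ≋-refl) , +ₚ-identityʳ }
          ; inverse = (λ p → ≋-trans (+ₚ-comm (negₚ p) p) (-ₚ-self p)) , -ₚ-self
          ; ⁻¹-cong = negₚ-cong }
        ; comm = +ₚ-comm }
      ; *-cong = *ₚ-cong
      ; *-assoc = *ₚ-assoc
      ; *-identity = *ₚ-identityˡ , *ₚ-identityʳ
      ; distrib = *ₚ-distribˡ-+ₚ , *ₚ-distribʳ-+ₚ }
    ; *-comm = *ₚ-comm }

  commutativeRing : CommutativeRing _ _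
  commutativeRing = record { isCommutativeRing = isCommutativeRing }

  const : ℤ → Poly
  const c = c ∷ []

  const-*ₚ : ∀ a b → const (a * b) ≋ const a *ₚ const b
  const-*ₚ a b = mk≋ λ { zero → sym (ℤ.+-identityʳ (a * b)) ; (suc k) → refl }

  const-*ₚ-scale : ∀ c p → const c *ₚ p ≋ map (c *_) p
  const-*ₚ-scale c p =
    ≋-trans (+ₚ-cong {q = + 0 ∷ []} {[]} ≋-refl (mk≋ λ { zero → refl ; (suc k) → refl })) (+ₚ-identityʳ _)

  private
    almostCommutativeRing : AlmostCommutativeRing _ _
    almostCommutativeRing = fromCommutativeRing commutativeRing

    constHom : ℤ.+-*-rawRing -Raw-AlmostCommutative⟶ almostCommutativeRing
    constHom = record
      { ⟦_⟧    = const
      ; +-homo = λ a b → ≋-refl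
      ; *-homo = const-*ₚ
      ; -‿homo = λ a → ≋-refl
      ; 0-homo = mk≋ λ { zero → refl ; (suc k) → refl }
      ; 1-homo = ≋-refl }

    const-≟ : ∀ a b → Maybe (const a ≋ const b)
    const-≟ a b with a ℤ.≟ b
    ... | yes refl = just ≋-refl
    ... | no _     = nothing

  open Algebra.Solver.Ring ℤ.+-*-rawRing almostCommutativeRing constHom const-≟ public
    using (solve; _:=_; _:+_; _:*_; :-_; _:-_; con)

module Degree where

  open PolyRing
  open import Data.Nat as ℕ using (ℕ; zero; suc; _≤_; _<_; z≤n; s≤s; _∸_)
  import Data.Nat.Properties as ℕ
  open import Data.Integer as ℤ using (ℤ; +_; -[1+_]; _+_; _*_)
  import Data.Integer.Properties as ℤ
  open import Data.List using ([]; _∷_; _∷ʳ_; map; reverse; length)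
  open import Data.List.Properties using (reverse-involutive; length-reverse; unfold-reverse)
  open import Data.Product using (_×_; _,_)
  open import Data.Sum using (_⊎_; inj₁; inj₂)
  open import Data.Empty using (⊥-elim)
  open import Relation.Binary.PropositionalEquality
  open import Relation.Binary.Definitions using (tri<; tri≈; tri>)
  open import Relation.Nullary using (¬_; yes; no)
  import Relation.Binary.Reasoning.Setoid as SetoidReasoning
  open import Algebra.Bundles using (CommutativeRing)

  DegreeBelow : ℕ → Poly → Set
  DegreeBelow N p = ∀ k → N ≤ k → coeff p k ≡ + 0

  DegreeBelow-≋ : ∀ {N p q} → p ≋ q → DegreeBelow N q → DegreeBelow N p
  DegreeBelow-≋ (mk≋ e) below k N≤k = trans (e k) (below k N≤k)

  degreeBelow-length : ∀ p → DegreeBelow (length p) p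
  degreeBelow-length []      k       _         = refl
  degreeBelow-length (a ∷ p) (suc k) (s≤s p≤k) = degreeBelow-length p k p≤k

  coeff-∷ʳ-0 : ∀ p k → coeff (p ∷ʳ + 0) k ≡ coeff p k
  coeff-∷ʳ-0 []      zero    = refl
  coeff-∷ʳ-0 []      (suc k) = refl
  coeff-∷ʳ-0 (a ∷ p) zero    = refl
  coeff-∷ʳ-0 (a ∷ p) (suc k) = coeff-∷ʳ-0 p k

  coeff-∷ʳ-length : ∀ p y → coeff (p ∷ʳ y) (length p) ≡ y
  coeff-∷ʳ-length []      y = refl
  coeff-∷ʳ-length (a ∷ p) y = coeff-∷ʳ-length p y

  record Shortens (t p : Poly) : Set where
    field
      ≋-original     : t ≋ p
      length-minimal : ∀ {N} → DegreeBelow N p → length t ≤ N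

  private
    Shortens-≋ : ∀ {t p q} → p ≋ q → Shortens t q → Shortens t p
    Shortens-≋ p≋q s = record
      { ≋-original     = ≋-trans (Shortens.≋-original s) (≋-sym p≋q)
      ; length-minimal = λ below → Shortens.length-minimal s (DegreeBelow-≋ (≋-sym p≋q) below) }

    reverse-shortens-itself : ∀ y ys → ¬ y ≡ + 0 → Shortens (reverse (y ∷ ys)) (reverse (y ∷ ys))
    reverse-shortens-itself y ys y≢0 = record { ≋-original = ≋-refl ; length-minimal = minimal }
      where
      minimal : ∀ {N} → DegreeBelow N (reverse (y ∷ ys)) → length (reverse (y ∷ ys)) ≤ N
      minimal {N} below with N ℕ.≤? length ys
      ... | no  N≰ys = subst (_≤ N) (sym (length-reverse (y ∷ ys))) (ℕ.≰⇒> N≰ys)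
      ... | yes N≤ys = ⊥-elim (y≢0 (begin
        y
          ≡⟨ coeff-∷ʳ-length (reverse ys) y ⟨
        coeff (reverse ys ∷ʳ y) (length (reverse ys))
          ≡⟨ cong (λ r → coeff r _) (unfold-reverse y ys) ⟨
        coeff (reverse (y ∷ ys)) (length (reverse ys))
          ≡⟨ below _ (subst (N ≤_) (sym (length-reverse ys)) N≤ys) ⟩
        + 0 ∎))
        where open ≡-Reasoning

    -- trimₚ drops the zeros at the head of the reversed list, so it computes by
    -- recursion on that list.
    trimₚ-reverse : ∀ ys → Shortens (trimₚ (reverse ys)) (reverse ys)
    trimₚ-reverse ys with reverse (reverse ys) | reverse-involutive ys
    trimₚ-reverse [] | _ | refl = record { ≋-original = ≋-refl ; length-minimal = λ _ → z≤n }
    trimₚ-reverse (+ zero ∷ ys) | _ | refl with reverse (reverse ys) | reverse-involutive ys | trimₚ-reverse ys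
    ... | _ | refl | shortens =
      Shortens-≋ (≋-trans (≡⇒≋ (unfold-reverse (+ 0) ys)) (mk≋ (coeff-∷ʳ-0 (reverse ys)))) shortens
    trimₚ-reverse (+ suc n  ∷ ys) | _ | refl = reverse-shortens-itself (+ suc n) ys λ ()
    trimₚ-reverse (-[1+ n ] ∷ ys) | _ | refl = reverse-shortens-itself -[1+ n ] ys λ ()

  trimₚ-shortens : ∀ p → Shortens (trimₚ p) p
  trimₚ-shortens p = subst (λ q → Shortens (trimₚ q) q) (reverse-involutive p) (trimₚ-reverse (reverse p))

  trimₚ-≋ : ∀ p → trimₚ p ≋ p
  trimₚ-≋ p = Shortens.≋-original (trimₚ-shortens p)

  length-trimₚ≤ : ∀ {N} p → DegreeBelow N p → length (trimₚ p) ≤ N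
  length-trimₚ≤ p = Shortens.length-minimal (trimₚ-shortens p)

  record Monic (M : Poly) (δ : ℕ) : Set where
    constructor monic
    field
      leading : coeff M δ ≡ + 1
      below   : DegreeBelow (suc δ) M
  open Monic public

  Monic-≋ : ∀ {p q δ} → p ≋ q → Monic q δ → Monic p δ
  Monic-≋ {p} {q} (mk≋ e) (monic lead below) = monic (trans (e _) lead) (DegreeBelow-≋ {p = p} {q} (mk≋ e) below)

  monic-oneₚ : Monic oneₚ 0
  monic-oneₚ = monic refl λ { (suc k) _ → refl }

  length-trimₚ-monic : ∀ {q δ} → Monic q δ → length (trimₚ q) ≡ suc δ
  length-trimₚ-monic {q} {δ} m = ℕ.≤-antisym (length-trimₚ≤ q (below m)) (ℕ.≰⇒> δ≱)
    where
    δ≱ : ¬ length (trimₚ q) ≤ δ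
    δ≱ short with () ← trans (sym (leading m))
                             (trans (sym (coeff-≡ (trimₚ-≋ q) δ)) (degreeBelow-length (trimₚ q) δ short))

  coeff-*ₚ-∷ : ∀ M x X k → coeff (M *ₚ (x ∷ X)) k ≡ x * coeff M k + coeff (+ 0 ∷ (M *ₚ X)) k
  coeff-*ₚ-∷ M x X k =
    trans (coeff-≡ (*ₚ-∷ʳ M x X) k)
          (trans (coeff-+ₚ (map (x *_) M) _ k) (cong (_+ coeff (+ 0 ∷ (M *ₚ X)) k) (coeff-scale x M k)))

  private
    coeff-0∷-zero : ∀ {Y} k → Y ≋ [] → coeff (+ 0 ∷ Y) k ≡ + 0
    coeff-0∷-zero zero    _ = refl
    coeff-0∷-zero (suc k) z = coeff-≡ z k

    *ₚ-zero-right : ∀ M {Y} → Y ≋ [] → M *ₚ Y ≋ []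
    *ₚ-zero-right M z = ≋-trans (*ₚ-congˡ M z) (*ₚ-zeroʳ M)

  -- M (x ∷ X) = x M + (0 ∷ M X): the tail X inherits the hypothesis, after which
  -- the coefficient at δ is x.
  monic-*ₚ-degreeBelow : ∀ {M δ} → Monic M δ → ∀ X → DegreeBelow δ (M *ₚ X) → X ≋ []
  monic-*ₚ-degreeBelow m []      _     = ≋-refl
  monic-*ₚ-degreeBelow {M} {δ} m (x ∷ X) small = mk≋ λ { zero → x≡0 ; (suc k) → coeff-≡ X≋0 k }
    where
    open ≡-Reasoning
    small-tail : DegreeBelow δ (M *ₚ X)
    small-tail j δ≤j = begin
      coeff (M *ₚ X) j
        ≡⟨ ℤ.+-identityˡ _ ⟨
      + 0 + coeff (M *ₚ X) j
        ≡⟨ cong (_+ coeff (M *ₚ X) j) (trans (cong (x *_) (below m (suc j) (s≤s δ≤j))) (ℤ.*-zeroʳ x)) ⟨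
      x * coeff M (suc j) + coeff (M *ₚ X) j
        ≡⟨ coeff-*ₚ-∷ M x X (suc j) ⟨
      coeff (M *ₚ (x ∷ X)) (suc j)
        ≡⟨ small (suc j) (ℕ.m≤n⇒m≤1+n δ≤j) ⟩
      + 0 ∎
    X≋0 : X ≋ []
    X≋0 = monic-*ₚ-degreeBelow m X small-tail
    x≡0 : x ≡ + 0
    x≡0 = begin
      x
        ≡⟨ ℤ.*-identityʳ x ⟨
      x * + 1
        ≡⟨ cong (x *_) (leading m) ⟨
      x * coeff M δ
        ≡⟨ ℤ.+-identityʳ _ ⟨
      x * coeff M δ + + 0
        ≡⟨ cong (_+_ (x * coeff M δ)) (coeff-0∷-zero δ (*ₚ-zero-right M X≋0)) ⟨
      x * coeff M δ + coeff (+ 0 ∷ (M *ₚ X)) δ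
        ≡⟨ coeff-*ₚ-∷ M x X δ ⟨
      coeff (M *ₚ (x ∷ X)) δ
        ≡⟨ small δ ℕ.≤-refl ⟩
      + 0 ∎

  record LeadingTerm (X : Poly) : Set where
    constructor leadingTerm
    field
      degree    : ℕ
      nonzero   : ¬ coeff X degree ≡ + 0
      belowNext : DegreeBelow (suc degree) X

  zero⊎leadingTerm : ∀ X → X ≋ [] ⊎ LeadingTerm X
  zero⊎leadingTerm []      = inj₁ ≋-refl
  zero⊎leadingTerm (x ∷ X) with zero⊎leadingTerm X
  ... | inj₂ (leadingTerm e x≢0 below) = inj₂ (leadingTerm (suc e) x≢0 λ { (suc k) (s≤s e≤k) → below k e≤k })
  ... | inj₁ X≋0 with x ℤ.≟ + 0
  ...   | yes x≡0 = inj₁ (mk≋ λ { zero → x≡0 ; (suc k) → coeff-≡ X≋0 k })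
  ...   | no  x≢0 = inj₂ (leadingTerm 0 x≢0 λ { (suc k) _ → coeff-≡ X≋0 k })

  monic-*ₚ-leading : ∀ {M δ} → Monic M δ → ∀ X e → DegreeBelow (suc e) X →
                     coeff (M *ₚ X) (δ ℕ.+ e) ≡ coeff X e × DegreeBelow (suc (δ ℕ.+ e)) (M *ₚ X)
  monic-*ₚ-leading {M} {δ} m [] e _ = coeff-≡ (*ₚ-zeroʳ M) _ , λ k _ → coeff-≡ (*ₚ-zeroʳ M) k
  monic-*ₚ-leading {M} {δ} m (x ∷ X) zero below-1 rewrite ℕ.+-identityʳ δ =
    trans (coeff-const δ) (trans (cong (x *_) (leading m)) (ℤ.*-identityʳ x)) ,
    λ k δ<k → trans (coeff-const k) (trans (cong (x *_) (below m k δ<k)) (ℤ.*-zeroʳ x))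
    where
    coeff-const : ∀ k → coeff (M *ₚ (x ∷ X)) k ≡ x * coeff M k
    coeff-const k = trans (coeff-*ₚ-∷ M x X k)
      (trans (cong (_+_ (x * coeff M k)) (coeff-0∷-zero k (*ₚ-zero-right M (mk≋ λ j → below-1 (suc j) (s≤s z≤n)))))
             (ℤ.+-identityʳ _))
  monic-*ₚ-leading {M} {δ} m (x ∷ X) (suc e) below-e
    with monic-*ₚ-leading m X e (λ k e<k → below-e (suc k) (s≤s e<k))
  ... | top , rest rewrite ℕ.+-suc δ e = top′ , rest′
    where
    x*high : ∀ {k} → δ < k → x * coeff M k ≡ + 0
    x*high δ<k = trans (cong (x *_) (below m _ δ<k)) (ℤ.*-zeroʳ x)
    top′ : coeff (M *ₚ (x ∷ X)) (suc (δ ℕ.+ e)) ≡ coeff X e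
    top′ = trans (coeff-*ₚ-∷ M x X _)
      (trans (cong₂ _+_ (x*high (s≤s (ℕ.m≤m+n δ e))) top) (ℤ.+-identityˡ _))
    rest′ : DegreeBelow (suc (suc (δ ℕ.+ e))) (M *ₚ (x ∷ X))
    rest′ (suc k) (s≤s δe<k) = trans (coeff-*ₚ-∷ M x X (suc k))
      (cong₂ _+_ (x*high (s≤s (ℕ.≤-trans (ℕ.m≤m+n δ e) (ℕ.≤-trans (ℕ.n≤1+n _) δe<k)))) (rest k δe<k))

  monic-*ₚ : ∀ {A B α β} → Monic A α → Monic B β → Monic (A *ₚ B) (α ℕ.+ β)
  monic-*ₚ {B = B} {β = β} mA mB with monic-*ₚ-leading mA B β (below mB)
  ... | top , rest = monic (trans top (leading mB)) rest

  monic-quotient : ∀ {P X δ μ} → Monic P δ → Monic (P *ₚ X) μ → Monic X (μ ∸ δ)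
  monic-quotient {P} {X} {δ} {μ} mP mPX with zero⊎leadingTerm X
  ... | inj₁ X≋0 with () ← trans (sym (leading mPX)) (coeff-≡ (*ₚ-zero-right P X≋0) μ)
  ... | inj₂ (leadingTerm e x≢0 belowX) with monic-*ₚ-leading mP X e belowX
  ...   | top , rest with ℕ.<-cmp (δ ℕ.+ e) μ
  ...     | tri< δe<μ _ _ with () ← trans (sym (leading mPX)) (rest μ δe<μ)
  ...     | tri> _ _ μ<δe = ⊥-elim (x≢0 (trans (sym top) (below mPX _ μ<δe)))
  ...     | tri≈ _ δe≡μ _ = subst (Monic X) (trans (sym (ℕ.m+n∸m≡n δ e)) (cong (_∸ δ) δe≡μ))
                                  (monic (trans (sym top) (trans (cong (coeff (P *ₚ X)) δe≡μ) (leading mPX))) belowX)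

  monic-*ₚ-cancelˡ : ∀ {M δ} → Monic M δ → ∀ A B → M *ₚ A ≋ M *ₚ B → A ≋ B
  monic-*ₚ-cancelˡ {M} m A B MA≋MB = begin
    A                 ≈⟨ solve 2 (λ A B → A := (A :- B) :+ B) ≋-refl A B ⟩
    (A -ₚ B) +ₚ B     ≈⟨ +ₚ-cong (monic-*ₚ-degreeBelow m (A -ₚ B) λ k _ → coeff-≡ M[A-B]≋0 k) ≋-refl ⟩
    B                 ∎
    where
    open SetoidReasoning (CommutativeRing.setoid commutativeRing)
    M[A-B]≋0 : M *ₚ (A -ₚ B) ≋ []
    M[A-B]≋0 = begin
      M *ₚ (A -ₚ B)        ≈⟨ solve 3 (λ M A B → M :* (A :- B) := M :* A :- M :* B) ≋-refl M A B ⟩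
      M *ₚ A -ₚ M *ₚ B     ≈⟨ +ₚ-cong MA≋MB ≋-refl ⟩
      M *ₚ B -ₚ M *ₚ B     ≈⟨ -ₚ-self (M *ₚ B) ⟩
      []                   ∎

module Division where

  open PolyRing
  open Degree
  open import Data.Nat as ℕ using (ℕ; zero; suc; _≤_; _<_; _∸_; _<ᵇ_)
  import Data.Nat.Properties as ℕ
  open import Data.Integer as ℤ using (ℤ; +_; _+_; _*_; _-_)
  import Data.Integer.Properties as ℤ
  open import Data.Bool using (true; false; T)
  open import Data.List using (List; []; _∷_; map; length)
  open import Data.Sum using (inj₁; inj₂)
  open import Relation.Binary.PropositionalEquality
  import Relation.Binary.Reasoning.Setoid as SetoidReasoning
  open import Algebra.Bundles using (CommutativeRing)

  coeff-monomial-*ₚ : ∀ s c r j → coeff (monomial s c *ₚ r) (s ℕ.+ j) ≡ c * coeff r j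
  coeff-monomial-*ₚ zero    c r j = trans (coeff-+ₚ (map (c *_) r) (+ 0 ∷ []) j)
    (trans (cong₂ _+_ (coeff-scale c r j) (coeff-0∷[] j)) (ℤ.+-identityʳ _))
    where
    coeff-0∷[] : ∀ j → coeff (+ 0 ∷ []) j ≡ + 0
    coeff-0∷[] zero    = refl
    coeff-0∷[] (suc j) = refl
  coeff-monomial-*ₚ (suc s) c r j = trans (coeff-≡ (0∷-*ₚ (monomial s c) r) (suc (s ℕ.+ j))) (coeff-monomial-*ₚ s c r j)

  -- Defs keeps the function returning the last entry of a list private.  The
  -- body of lastEntry is a metavariable, solved to that function by unification
  -- in the proof of divMonicFuel-suc.
  mutual
    lastEntry : List ℤ → ℤ
    lastEntry = _

    divMonicFuel-suc : ∀ f p q → (length (trimₚ p) <ᵇ length (trimₚ q)) ≡ false →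
      let t = monomial (length (trimₚ p) ∸ length (trimₚ q)) (lastEntry (trimₚ p)) in
      divMonicFuel (suc f) p q ≡ t +ₚ divMonicFuel f (trimₚ p -ₚ t *ₚ trimₚ q) (trimₚ q)
    divMonicFuel-suc f p q p≮q with trimₚ p | trimₚ q
    ... | w | v with length w <ᵇ length v
    divMonicFuel-suc f p q refl | w | v | false = refl

  divMonicFuel-suc-short : ∀ f p q → (length (trimₚ p) <ᵇ length (trimₚ q)) ≡ true →
                           divMonicFuel (suc f) p q ≡ []
  divMonicFuel-suc-short f p q p<ᵇq rewrite p<ᵇq = refl

  lastEntry-≡-topCoeff : ∀ w → lastEntry w ≡ coeff w (length w ∸ 1)
  lastEntry-≡-topCoeff []           = refl
  lastEntry-≡-topCoeff (x ∷ [])     = refl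
  lastEntry-≡-topCoeff (x ∷ y ∷ ys) = lastEntry-≡-topCoeff (y ∷ ys)

  cancel-leadingTerm : ∀ {v δ} → Monic v δ → ∀ w s {c} → length w ≡ s ℕ.+ suc δ → c ≡ coeff w (s ℕ.+ δ) →
                       DegreeBelow (s ℕ.+ δ) (w -ₚ monomial s c *ₚ v)
  cancel-leadingTerm {v} {δ} mv w s {c} len c≡ k s+δ≤k =
    subst (λ i → coeff (w -ₚ t *ₚ v) i ≡ + 0) (ℕ.m+[n∸m]≡n s≤k)
          (vanishes (k ∸ s) (ℕ.m+n≤o⇒m≤o∸n δ (subst (_≤ k) (ℕ.+-comm s δ) s+δ≤k)))
    where
    open ≡-Reasoning
    t = monomial s c
    s≤k = ℕ.≤-trans (ℕ.m≤m+n s δ) s+δ≤k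
    vanishes : ∀ j → δ ≤ j → coeff (w -ₚ t *ₚ v) (s ℕ.+ j) ≡ + 0
    vanishes j δ≤j with ℕ.m≤n⇒m<n∨m≡n δ≤j
    ... | inj₂ refl = begin
      coeff (w -ₚ t *ₚ v) (s ℕ.+ δ)                 ≡⟨ coeff--ₚ w (t *ₚ v) _ ⟩
      coeff w (s ℕ.+ δ) - coeff (t *ₚ v) (s ℕ.+ δ)   ≡⟨ cong₂ _-_ (sym c≡) (coeff-monomial-*ₚ s c v δ) ⟩
      c - c * coeff v δ                             ≡⟨ cong (λ a → c - c * a) (leading mv) ⟩
      c - c * + 1                                   ≡⟨ cong (c -_) (ℤ.*-identityʳ c) ⟩
      c - c                                         ≡⟨ ℤ.+-inverseʳ c ⟩
      + 0                                           ∎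
    ... | inj₁ δ<j = begin
      coeff (w -ₚ t *ₚ v) (s ℕ.+ j)                 ≡⟨ coeff--ₚ w (t *ₚ v) _ ⟩
      coeff w (s ℕ.+ j) - coeff (t *ₚ v) (s ℕ.+ j)   ≡⟨ cong₂ _-_ w-high (coeff-monomial-*ₚ s c v j) ⟩
      + 0 - c * coeff v j                           ≡⟨ cong (λ a → + 0 - c * a) (below mv j δ<j) ⟩
      + 0 - c * + 0                                 ≡⟨ cong (+ 0 -_) (ℤ.*-zeroʳ c) ⟩
      + 0                                           ∎
      where
      w-high : coeff w (s ℕ.+ j) ≡ + 0
      w-high = degreeBelow-length w _ (subst (_≤ s ℕ.+ j) (sym len) (ℕ.+-monoʳ-≤ s δ<j))

  private
    module _ where
      open SetoidReasoning (CommutativeRing.setoid commutativeRing)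

      remainder-step : ∀ p q w v t D → w ≋ p → v ≋ q → p -ₚ q *ₚ (t +ₚ D) ≋ (w -ₚ t *ₚ v) -ₚ v *ₚ D
      remainder-step p q w v t D w≋p v≋q = begin
        p -ₚ q *ₚ (t +ₚ D)
          ≈⟨ +ₚ-cong (≋-sym w≋p) (negₚ-cong (*ₚ-congʳ (t +ₚ D) (≋-sym v≋q))) ⟩
        w -ₚ v *ₚ (t +ₚ D)
          ≈⟨ solve 4 (λ w v t D → w :- v :* (t :+ D) := (w :- t :* v) :- v :* D) ≋-refl w v t D ⟩
        (w -ₚ t *ₚ v) -ₚ v *ₚ D ∎

      remainder-of-[] : ∀ p q δ → length (trimₚ p) ≤ δ → DegreeBelow δ (p -ₚ q *ₚ [])
      remainder-of-[] p q δ short =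
        DegreeBelow-≋ p-q*[]≋trim λ k δ≤k → degreeBelow-length (trimₚ p) k (ℕ.≤-trans short δ≤k)
        where
        p-q*[]≋trim : p -ₚ q *ₚ [] ≋ trimₚ p
        p-q*[]≋trim = begin
          p -ₚ q *ₚ [] ≈⟨ +ₚ-cong ≋-refl (negₚ-cong (*ₚ-zeroʳ q)) ⟩
          p +ₚ []      ≈⟨ +ₚ-identityʳ p ⟩
          p            ≈⟨ ≋-sym (trimₚ-≋ p) ⟩
          trimₚ p      ∎

    division-step : ∀ f p q w v δ {c} → w ≋ p → v ≋ q → Monic v δ → length v ≡ suc δ →
                    length v ≤ length w → length w ≤ suc f ℕ.+ δ → c ≡ coeff w (length w ∸ 1) →
                    (∀ p′ → length (trimₚ p′) ≤ f ℕ.+ δ → DegreeBelow δ (p′ -ₚ v *ₚ divMonicFuel f p′ v)) →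
                    let t = monomial (length w ∸ length v) c in
                    DegreeBelow δ (p -ₚ q *ₚ (t +ₚ divMonicFuel f (w -ₚ t *ₚ v) v))
    division-step f p q w v δ {c} w≋p v≋q mv v-length v≤w w≤ c≡ recurse =
      DegreeBelow-≋ (remainder-step p q w v t D w≋p v≋q)
        (recurse (w -ₚ t *ₚ v)
          (ℕ.≤-trans (length-trimₚ≤ (w -ₚ t *ₚ v)
                       (cancel-leadingTerm mv w s w-length (trans c≡ (cong (coeff w) w-length∸1))))
                     s+δ≤f+δ))
      where
      s = length w ∸ length v
      t = monomial s c
      D = divMonicFuel f (w -ₚ t *ₚ v) v
      w-length : length w ≡ s ℕ.+ suc δ
      w-length = trans (sym (ℕ.m∸n+n≡m v≤w)) (cong (s ℕ.+_) v-length)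
      w-length∸1 : length w ∸ 1 ≡ s ℕ.+ δ
      w-length∸1 = trans (cong (_∸ 1) w-length) (cong (_∸ 1) (ℕ.+-suc s δ))
      s+δ≤f+δ : s ℕ.+ δ ≤ f ℕ.+ δ
      s+δ≤f+δ = subst (_≤ f ℕ.+ δ) w-length∸1 (ℕ.∸-monoˡ-≤ 1 w≤)

  -- Each round of long division lowers the length of the dividend by one, so a
  -- dividend of length at most fuel + δ is reduced below degree δ.
  remainder-degreeBelow : ∀ fuel p {q δ} → Monic q δ → length (trimₚ p) ≤ fuel ℕ.+ δ →
                          DegreeBelow δ (p -ₚ q *ₚ divMonicFuel fuel p q)
  remainder-degreeBelow zero p {q} {δ} _ short = remainder-of-[] p q δ short
  remainder-degreeBelow (suc f) p {q} {δ} mq short = by-comparison _ refl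
    where
    mv = Monic-≋ (trimₚ-≋ q) mq
    q-length = length-trimₚ-monic mq
    by-comparison : ∀ b → (length (trimₚ p) <ᵇ length (trimₚ q)) ≡ b →
                    DegreeBelow δ (p -ₚ q *ₚ divMonicFuel (suc f) p q)
    by-comparison true p<ᵇq rewrite divMonicFuel-suc-short f p q p<ᵇq =
      remainder-of-[] p q δ (ℕ.≤-pred (subst (length (trimₚ p) <_) q-length p<q))
      where p<q = ℕ.<ᵇ⇒< (length (trimₚ p)) (length (trimₚ q)) (subst T (sym p<ᵇq) _)
    by-comparison false p≮ᵇq rewrite divMonicFuel-suc f p q p≮ᵇq =
      division-step f p q (trimₚ p) (trimₚ q) δ (trimₚ-≋ p) (trimₚ-≋ q) mv q-length q≤p short
                    (lastEntry-≡-topCoeff (trimₚ p)) (λ p′ → remainder-degreeBelow f p′ mv)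
      where q≤p = ℕ.≮⇒≥ λ p<q → subst T p≮ᵇq (ℕ.<⇒<ᵇ p<q)

  divMonic-remainder : ∀ p {q δ} → Monic q δ → DegreeBelow δ (p -ₚ q *ₚ divMonic p q)
  divMonic-remainder p mq = remainder-degreeBelow (suc (length p)) p mq
    (ℕ.≤-trans (length-trimₚ≤ p (degreeBelow-length p)) (ℕ.≤-trans (ℕ.n≤1+n _) (ℕ.m≤m+n _ _)))

  divMonic-exact : ∀ {p q δ} X → Monic q δ → p ≋ q *ₚ X → divMonic p q ≋ X
  divMonic-exact {p} {q} X mq p≋qX = ≋-sym X≋Q
    where
    open SetoidReasoning (CommutativeRing.setoid commutativeRing)
    Q = divMonic p q
    q*[X-Q]≋rem : q *ₚ (X -ₚ Q) ≋ p -ₚ q *ₚ Q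
    q*[X-Q]≋rem = begin
      q *ₚ (X -ₚ Q)          ≈⟨ solve 3 (λ q X Q → q :* (X :- Q) := q :* X :- q :* Q) ≋-refl q X Q ⟩
      q *ₚ X -ₚ q *ₚ Q       ≈⟨ +ₚ-cong (≋-sym p≋qX) ≋-refl ⟩
      p -ₚ q *ₚ Q            ∎
    X-Q≋0 : X -ₚ Q ≋ []
    X-Q≋0 = monic-*ₚ-degreeBelow mq (X -ₚ Q) (DegreeBelow-≋ q*[X-Q]≋rem (divMonic-remainder p mq))
    X≋Q : X ≋ Q
    X≋Q = begin
      X                      ≈⟨ solve 2 (λ X Q → X := (X :- Q) :+ Q) ≋-refl X Q ⟩
      (X -ₚ Q) +ₚ Q          ≈⟨ +ₚ-cong X-Q≋0 ≋-refl ⟩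
      Q                      ∎

module PolyDivisibility where

  open PolyRing
  open Degree
  open Division
  open import Data.Integer as ℤ using (ℤ; +_; _*_)
  import Data.Integer.Properties as ℤ
  open import Data.List using ([])
  open import Data.Product using (Σ; _,_)
  open import Relation.Binary.PropositionalEquality using (_≡_; sym; trans; cong)
  open import Relation.Nullary using (¬_)
  import Relation.Binary.Reasoning.Setoid as SetoidReasoning
  open import Algebra.Bundles using (CommutativeRing)

  open SetoidReasoning (CommutativeRing.setoid commutativeRing)

  infix 4 _∣ₚ_
  _∣ₚ_ : Poly → Poly → Set
  A ∣ₚ F = Σ Poly λ Y → F ≋ A *ₚ Y

  ∣ₚ-respˡ-≋ : ∀ {A A′ F} → A ≋ A′ → A′ ∣ₚ F → A ∣ₚ F
  ∣ₚ-respˡ-≋ {A} {A′} A≋A′ (Y , F≋A′Y) = Y , ≋-trans F≋A′Y (*ₚ-congʳ Y (≋-sym A≋A′))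

  ∣ₚ-trans : ∀ {A B C} → A ∣ₚ B → B ∣ₚ C → A ∣ₚ C
  ∣ₚ-trans {A} (Y , B≋AY) (Z , C≋BZ) = Y *ₚ Z , ≋-trans C≋BZ (≋-trans (*ₚ-congʳ Z B≋AY) (*ₚ-assoc A Y Z))

  private
    scale-≋[]⇒≋[] : ∀ {c} R → ¬ c ≡ + 0 → const c *ₚ R ≋ [] → R ≋ []
    scale-≋[]⇒≋[] {c} R c≢0 cR≋0 = mk≋ λ k → ℤ.*-cancelˡ-≡ c (coeff R k) (+ 0) {{ℤ.≢-nonZero c≢0}}
      (trans (sym (coeff-scale c R k)) (trans (sym (coeff-≡ (const-*ₚ-scale c R) k))
             (trans (coeff-≡ cR≋0 k) (sym (ℤ.*-zeroʳ c)))))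

  -- Divide F by M; the remainder R satisfies M (Y - c Q) = c R, which has degree
  -- below deg M, so c R and hence R vanish.
  monic-∣ₚ-unscale : ∀ {M δ c F} → Monic M δ → ¬ c ≡ + 0 → M ∣ₚ const c *ₚ F → M ∣ₚ F
  monic-∣ₚ-unscale {M} {δ} {c} {F} mM c≢0 (Y , cF≋MY) = Q , F≋MQ
    where
    Q = divMonic F M
    R = F -ₚ M *ₚ Q
    C = const c
    M[Y-CQ]≋CR : M *ₚ (Y -ₚ C *ₚ Q) ≋ C *ₚ R
    M[Y-CQ]≋CR = begin
      M *ₚ (Y -ₚ C *ₚ Q)
        ≈⟨ solve 4 (λ M Y C Q → M :* (Y :- C :* Q) := M :* Y :- C :* (M :* Q)) ≋-refl M Y C Q ⟩
      M *ₚ Y -ₚ C *ₚ (M *ₚ Q)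
        ≈⟨ +ₚ-cong (≋-sym cF≋MY) ≋-refl ⟩
      C *ₚ F -ₚ C *ₚ (M *ₚ Q)
        ≈⟨ solve 3 (λ C F MQ → C :* F :- C :* MQ := C :* (F :- MQ)) ≋-refl C F (M *ₚ Q) ⟩
      C *ₚ R ∎
    CR-small : DegreeBelow δ (C *ₚ R)
    CR-small k δ≤k = trans (coeff-≡ (const-*ₚ-scale c R) k)
      (trans (coeff-scale c R k) (trans (cong (c *_) (divMonic-remainder F mM k δ≤k)) (ℤ.*-zeroʳ c)))
    Y-CQ≋0 : Y -ₚ C *ₚ Q ≋ []
    Y-CQ≋0 = monic-*ₚ-degreeBelow mM _ (DegreeBelow-≋ M[Y-CQ]≋CR CR-small)
    R≋0 : R ≋ []
    R≋0 = scale-≋[]⇒≋[] R c≢0 (begin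
      C *ₚ R                      ≈⟨ ≋-sym M[Y-CQ]≋CR ⟩
      M *ₚ (Y -ₚ C *ₚ Q)          ≈⟨ *ₚ-congˡ M Y-CQ≋0 ⟩
      M *ₚ []                     ≈⟨ *ₚ-zeroʳ M ⟩
      []                          ∎)
    F≋MQ : F ≋ M *ₚ Q
    F≋MQ = begin
      F                           ≈⟨ solve 2 (λ F MQ → F := (F :- MQ) :+ MQ) ≋-refl F (M *ₚ Q) ⟩
      R +ₚ M *ₚ Q                 ≈⟨ +ₚ-cong R≋0 ≋-refl ⟩
      M *ₚ Q                      ∎

  -- Coprimality over ℚ: a Bézout identity up to a nonzero integer constant.
  record Coprime (A B : Poly) : Set where
    constructor coprime
    field
      c      : ℤ
      c≢0    : ¬ c ≡ + 0
      u v    : Poly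
      bezout : u *ₚ A +ₚ v *ₚ B ≋ const c

  Coprime-respˡ-≋ : ∀ {A A′ B} → A ≋ A′ → Coprime A′ B → Coprime A B
  Coprime-respˡ-≋ {B = B} A≋A′ (coprime c c≢0 u v e) =
    coprime c c≢0 u v (≋-trans (+ₚ-cong (*ₚ-congˡ u A≋A′) ≋-refl) e)

  Coprime-∣ₚ : ∀ {A A′ B B′} → A ∣ₚ A′ → B ∣ₚ B′ → Coprime A′ B′ → Coprime A B
  Coprime-∣ₚ {A} {A′} {B} {B′} (Y , A′≋AY) (Z , B′≋BZ) (coprime c c≢0 u v e) =
    coprime c c≢0 (u *ₚ Y) (v *ₚ Z) (begin
      u *ₚ Y *ₚ A +ₚ v *ₚ Z *ₚ B
        ≈⟨ solve 6 (λ u Y A v Z B → u :* Y :* A :+ v :* Z :* B := u :* (A :* Y) :+ v :* (B :* Z)) ≋-refl u Y A v Z B ⟩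
      u *ₚ (A *ₚ Y) +ₚ v *ₚ (B *ₚ Z)
        ≈⟨ +ₚ-cong (*ₚ-congˡ u A′≋AY) (*ₚ-congˡ v B′≋BZ) ⟨
      u *ₚ A′ +ₚ v *ₚ B′
        ≈⟨ e ⟩
      const c ∎)

  coprime-oneₚ : ∀ B → Coprime oneₚ B
  coprime-oneₚ B = coprime (+ 1) (λ ()) oneₚ [] (*ₚ-identityˡ oneₚ)

  Coprime-*ₚ : ∀ {A B C} → Coprime A C → Coprime B C → Coprime (A *ₚ B) C
  Coprime-*ₚ {A} {B} {C} (coprime a a≢0 u v e) (coprime b b≢0 u′ v′ e′) =
    coprime (a * b) ab≢0 (u *ₚ u′) (u *ₚ A *ₚ v′ +ₚ v *ₚ u′ *ₚ B +ₚ v *ₚ v′ *ₚ C) (begin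
      u *ₚ u′ *ₚ (A *ₚ B) +ₚ (u *ₚ A *ₚ v′ +ₚ v *ₚ u′ *ₚ B +ₚ v *ₚ v′ *ₚ C) *ₚ C
        ≈⟨ solve 7 (λ u A v C u′ B v′ → (u :* u′) :* (A :* B) :+ (u :* A :* v′ :+ v :* u′ :* B :+ v :* v′ :* C) :* C
                                        := (u :* A :+ v :* C) :* (u′ :* B :+ v′ :* C)) ≋-refl u A v C u′ B v′ ⟩
      (u *ₚ A +ₚ v *ₚ C) *ₚ (u′ *ₚ B +ₚ v′ *ₚ C)
        ≈⟨ *ₚ-cong e e′ ⟩
      const a *ₚ const b
        ≈⟨ const-*ₚ a b ⟨
      const (a * b) ∎)
    where
    ab≢0 : ¬ a * b ≡ + 0
    ab≢0 ab≡0 = b≢0 (ℤ.*-cancelˡ-≡ a b (+ 0) {{ℤ.≢-nonZero a≢0}} (trans ab≡0 (sym (ℤ.*-zeroʳ a))))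

  -- With F = A A′ = B B′ and u A + v B = c: c F = A B (u B′ + v A′).
  coprime-monic-∣ₚ : ∀ {A B F α β} → Monic A α → Monic B β →
                     A ∣ₚ F → B ∣ₚ F → Coprime A B → A *ₚ B ∣ₚ F
  coprime-monic-∣ₚ {A} {B} {F} mA mB (A′ , F≋AA′) (B′ , F≋BB′) (coprime c c≢0 u v e) =
    monic-∣ₚ-unscale (monic-*ₚ mA mB) c≢0 (u *ₚ B′ +ₚ v *ₚ A′ , (begin
      const c *ₚ F
        ≈⟨ *ₚ-congʳ F e ⟨
      (u *ₚ A +ₚ v *ₚ B) *ₚ F
        ≈⟨ *ₚ-distribʳ-+ₚ F (u *ₚ A) (v *ₚ B) ⟩
      u *ₚ A *ₚ F +ₚ v *ₚ B *ₚ F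
        ≈⟨ +ₚ-cong (*ₚ-congˡ (u *ₚ A) F≋BB′) (*ₚ-congˡ (v *ₚ B) F≋AA′) ⟩
      u *ₚ A *ₚ (B *ₚ B′) +ₚ v *ₚ B *ₚ (A *ₚ A′)
        ≈⟨ solve 6 (λ u A B B′ v A′ → u :* A :* (B :* B′) :+ v :* B :* (A :* A′)
                                      := (A :* B) :* (u :* B′ :+ v :* A′)) ≋-refl u A B B′ v A′ ⟩
      A *ₚ B *ₚ (u *ₚ B′ +ₚ v *ₚ A′) ∎))

module XPowMinusOne where

  open PolyRing
  open Degree
  open PolyDivisibility
  open import Data.Nat as ℕ using (ℕ; zero; suc; _≤_; s≤s)
  import Data.Nat.Properties as ℕ
  open import Data.Nat.Divisibility using (_∣_; divides)
  open import Data.Nat.GCD using (gcd; gcd-GCD; module Bézout)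
  open import Data.Integer using (+_)
  open import Data.List using ([])
  open import Data.Product using (Σ; _,_)
  open import Relation.Binary.PropositionalEquality using (_≡_; refl; sym; trans; cong)
  open import Relation.Nullary using (¬_; contradiction)
  import Relation.Binary.Reasoning.Setoid as SetoidReasoning
  open import Algebra.Bundles using (CommutativeRing)

  open SetoidReasoning (CommutativeRing.setoid commutativeRing)

  xpow : ℕ → Poly
  xpow k = monomial k (+ 1)

  xpow-+ : ∀ a b → xpow (a ℕ.+ b) ≋ xpow a *ₚ xpow b
  xpow-+ zero    b = ≋-sym (*ₚ-identityˡ (xpow b))
  xpow-+ (suc a) b = ≋-trans (0∷-cong (xpow-+ a b)) (≋-sym (0∷-*ₚ (xpow a) (xpow b)))

  xpow-1-+ : ∀ a b → xpow-1 (a ℕ.+ b) ≋ xpow a *ₚ xpow-1 b +ₚ xpow-1 a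
  xpow-1-+ a b = begin
    xpow-1 (a ℕ.+ b)
      ≈⟨ +ₚ-cong (xpow-+ a b) ≋-refl ⟩
    xpow a *ₚ xpow b -ₚ oneₚ
      ≈⟨ solve 2 (λ A B → A :* B :- con (+ 1) := A :* (B :- con (+ 1)) :+ (A :- con (+ 1))) ≋-refl (xpow a) (xpow b) ⟩
    xpow a *ₚ xpow-1 b +ₚ xpow-1 a ∎

  geomSum : ℕ → ℕ → Poly
  geomSum g zero    = []
  geomSum g (suc t) = oneₚ +ₚ xpow g *ₚ geomSum g t

  xpow-1-* : ∀ t g → xpow-1 (t ℕ.* g) ≋ xpow-1 g *ₚ geomSum g t
  xpow-1-* zero    g = ≋-trans (mk≋ λ { zero → refl ; (suc k) → refl }) (≋-sym (*ₚ-zeroʳ (xpow-1 g)))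
  xpow-1-* (suc t) g = begin
    xpow-1 (g ℕ.+ t ℕ.* g)
      ≈⟨ xpow-1-+ g (t ℕ.* g) ⟩
    xpow g *ₚ xpow-1 (t ℕ.* g) +ₚ xpow-1 g
      ≈⟨ +ₚ-cong (*ₚ-congˡ (xpow g) (xpow-1-* t g)) ≋-refl ⟩
    xpow g *ₚ (xpow-1 g *ₚ geomSum g t) +ₚ xpow-1 g
      ≈⟨ solve 3 (λ P X G → P :* (X :* G) :+ X := X :* (con (+ 1) :+ P :* G)) ≋-refl (xpow g) (xpow-1 g) (geomSum g t) ⟩
    xpow-1 g *ₚ geomSum g (suc t) ∎

  geomSum-mod-xpow-1 : ∀ g t → Σ Poly λ H → geomSum g t ≋ const (+ t) +ₚ xpow-1 g *ₚ H
  geomSum-mod-xpow-1 g zero    =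
    [] , ≋-sym (+ₚ-cong {q = xpow-1 g *ₚ []} (mk≋ λ { zero → refl ; (suc k) → refl }) (*ₚ-zeroʳ (xpow-1 g)))
  geomSum-mod-xpow-1 g (suc t) with geomSum-mod-xpow-1 g t
  ... | H , G≋t+XH = H +ₚ G , (begin
    oneₚ +ₚ P *ₚ G
      ≈⟨ solve 2 (λ P G → con (+ 1) :+ P :* G := (con (+ 1) :+ G) :+ (P :- con (+ 1)) :* G) ≋-refl P G ⟩
    (oneₚ +ₚ G) +ₚ X *ₚ G
      ≈⟨ +ₚ-cong (+ₚ-cong {oneₚ} ≋-refl G≋t+XH) ≋-refl ⟩
    (oneₚ +ₚ (const (+ t) +ₚ X *ₚ H)) +ₚ X *ₚ G
      ≈⟨ solve 4 (λ C X H G → (con (+ 1) :+ (C :+ X :* H)) :+ X :* G := (con (+ 1) :+ C) :+ X :* (H :+ G))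
                 ≋-refl (const (+ t)) X H G ⟩
    (oneₚ +ₚ const (+ t)) +ₚ X *ₚ (H +ₚ G) ∎)
    where
    P = xpow g
    X = xpow-1 g
    G = geomSum g t

  monic-xpow-1 : ∀ k → Monic (xpow-1 (suc k)) (suc k)
  monic-xpow-1 k = monic (trans (coeff-suc k) (coeff-xpow k)) λ
    { (suc j) (s≤s k<j) → trans (coeff-suc j) (coeff-xpow-≢ k j λ j≡k → ℕ.<-irrefl (sym j≡k) k<j) }
    where
    coeff-suc : ∀ j → coeff (xpow-1 (suc k)) (suc j) ≡ coeff (xpow k) j
    coeff-suc j = coeff-≡ (+ₚ-identityʳ (xpow k)) j
    coeff-xpow : ∀ k → coeff (xpow k) k ≡ + 1
    coeff-xpow zero    = refl
    coeff-xpow (suc k) = coeff-xpow k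
    coeff-xpow-≢ : ∀ k j → ¬ j ≡ k → coeff (xpow k) j ≡ + 0
    coeff-xpow-≢ zero    zero    j≢k = contradiction refl j≢k
    coeff-xpow-≢ zero    (suc j) _   = refl
    coeff-xpow-≢ (suc k) zero    _   = refl
    coeff-xpow-≢ (suc k) (suc j) j≢k = coeff-xpow-≢ k j λ j≡k → j≢k (cong suc j≡k)

  xpow-1-∣ₚ : ∀ {d m} → d ∣ m → xpow-1 d ∣ₚ xpow-1 m
  xpow-1-∣ₚ {d} (divides t refl) = geomSum d t , xpow-1-* t d

  private
    bezout-from : ∀ {g a b} x y → g ℕ.+ y ℕ.* b ≡ x ℕ.* a →
                  Σ Poly λ u → Σ Poly λ v → u *ₚ xpow-1 a +ₚ v *ₚ xpow-1 b ≋ xpow-1 g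
    bezout-from {g} {a} {b} x y eq = geomSum a x , negₚ (xpow g *ₚ geomSum b y) , (begin
      U *ₚ A +ₚ negₚ (P *ₚ V) *ₚ B
        ≈⟨ solve 5 (λ U A P V B → U :* A :+ (:- (P :* V)) :* B := A :* U :- P :* (B :* V)) ≋-refl U A P V B ⟩
      A *ₚ U -ₚ P *ₚ (B *ₚ V)
        ≈⟨ +ₚ-cong (xpow-1-* x a) (negₚ-cong (*ₚ-congˡ P (xpow-1-* y b))) ⟨
      xpow-1 (x ℕ.* a) -ₚ P *ₚ xpow-1 (y ℕ.* b)
        ≡⟨ cong (λ n → xpow-1 n -ₚ P *ₚ xpow-1 (y ℕ.* b)) (sym eq) ⟩
      xpow-1 (g ℕ.+ y ℕ.* b) -ₚ P *ₚ xpow-1 (y ℕ.* b)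
        ≈⟨ +ₚ-cong (xpow-1-+ g (y ℕ.* b)) ≋-refl ⟩
      (P *ₚ Y +ₚ xpow-1 g) -ₚ P *ₚ Y
        ≈⟨ solve 3 (λ P Y G → (P :* Y :+ G) :- P :* Y := G) ≋-refl P Y (xpow-1 g) ⟩
      xpow-1 g ∎)
      where
      U = geomSum a x
      V = geomSum b y
      P = xpow g
      A = xpow-1 a
      B = xpow-1 b
      Y = xpow-1 (y ℕ.* b)

  xpow-1-bezout : ∀ a b → Σ Poly λ u → Σ Poly λ v → u *ₚ xpow-1 a +ₚ v *ₚ xpow-1 b ≋ xpow-1 (gcd a b)
  xpow-1-bezout a b = from-identity (Bézout.identity (gcd-GCD a b))
    where
    from-identity : Bézout.Identity (gcd a b) a b →
                    Σ Poly λ u → Σ Poly λ v → u *ₚ xpow-1 a +ₚ v *ₚ xpow-1 b ≋ xpow-1 (gcd a b)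
    from-identity (Bézout.+- x y eq) = bezout-from {gcd a b} {a} {b} x y eq
    from-identity (Bézout.-+ x y eq) = swap (bezout-from {gcd a b} {b} {a} y x eq)
      where
      swap : (Σ Poly λ u → Σ Poly λ v → u *ₚ xpow-1 b +ₚ v *ₚ xpow-1 a ≋ xpow-1 (gcd a b)) →
             Σ Poly λ u → Σ Poly λ v → u *ₚ xpow-1 a +ₚ v *ₚ xpow-1 b ≋ xpow-1 (gcd a b)
      swap (u , v , e) = v , u , ≋-trans (+ₚ-comm (v *ₚ xpow-1 a) (u *ₚ xpow-1 b)) e

  -- x^g - 1 and geomSum g t are coprime because geomSum g t ≡ t modulo x^g - 1;
  -- geomSum g s and geomSum g t are coprime by the Bézout identity for x^(sg) - 1
  -- and x^(tg) - 1, cancelled by x^g - 1.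
  xpow-1-coprime-geomSum : ∀ {G} s t → 1 ≤ G → gcd (s ℕ.* G) (t ℕ.* G) ≡ G → ¬ t ≡ 0 →
                           Coprime (xpow-1 (s ℕ.* G)) (geomSum G t)
  xpow-1-coprime-geomSum {suc g} s t _ gcd≡g t≢0 =
    Coprime-respˡ-≋ (xpow-1-* s G) (Coprime-*ₚ coprime-X-Gt coprime-Gs-Gt)
    where
    G = suc g
    X = xpow-1 G
    Gs = geomSum G s
    Gt = geomSum G t
    coprime-X-Gt : Coprime X Gt
    coprime-X-Gt with geomSum-mod-xpow-1 G t
    ... | H , Gt≋t+XH = coprime (+ t) (λ { refl → t≢0 refl }) (negₚ H) oneₚ (begin
      negₚ H *ₚ X +ₚ oneₚ *ₚ Gt
        ≈⟨ +ₚ-cong {negₚ H *ₚ X} ≋-refl (*ₚ-congˡ oneₚ Gt≋t+XH) ⟩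
      negₚ H *ₚ X +ₚ oneₚ *ₚ (const (+ t) +ₚ X *ₚ H)
        ≈⟨ solve 3 (λ H X C → (:- H) :* X :+ con (+ 1) :* (C :+ X :* H) := C) ≋-refl H X (const (+ t)) ⟩
      const (+ t) ∎)
    coprime-Gs-Gt : Coprime Gs Gt
    coprime-Gs-Gt with xpow-1-bezout (s ℕ.* G) (t ℕ.* G)
    ... | u , v , bezout = coprime (+ 1) (λ ()) u v
      (monic-*ₚ-cancelˡ (monic-xpow-1 g) (u *ₚ Gs +ₚ v *ₚ Gt) oneₚ (begin
        X *ₚ (u *ₚ Gs +ₚ v *ₚ Gt)
          ≈⟨ solve 5 (λ X u A v B → X :* (u :* A :+ v :* B) := u :* (X :* A) :+ v :* (X :* B)) ≋-refl X u Gs v Gt ⟩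
        u *ₚ (X *ₚ Gs) +ₚ v *ₚ (X *ₚ Gt)
          ≈⟨ +ₚ-cong (*ₚ-congˡ u (xpow-1-* s G)) (*ₚ-congˡ v (xpow-1-* t G)) ⟨
        u *ₚ xpow-1 (s ℕ.* G) +ₚ v *ₚ xpow-1 (t ℕ.* G)
          ≈⟨ bezout ⟩
        xpow-1 (gcd (s ℕ.* G) (t ℕ.* G))
          ≡⟨ cong xpow-1 gcd≡g ⟩
        X
          ≈⟨ *ₚ-identityʳ X ⟨
        X *ₚ oneₚ ∎))

module Products where

  open PolyRing
  open import Data.Nat as ℕ using (ℕ; zero; suc; _≤_; _<_; z≤n; s≤s)
  import Data.Nat.Properties as ℕ
  open import Data.List using (List; []; _∷_; _++_; map; filter; length)
  import Data.List.Properties as List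
  open import Data.Empty using (⊥-elim)
  open import Data.Sum using (inj₁; inj₂)
  open import Relation.Binary.PropositionalEquality using (refl; sym; subst)
  open import Relation.Nullary using (¬_; Dec; yes; no; ¬?; _×-dec_)
  open import Relation.Unary using (Pred; Decidable)
  open import Level using (0ℓ)

  infixl 8 _^[_]
  _^[_] : ∀ {A : Set} → Poly → Dec A → Poly
  p ^[ yes _ ] = p
  p ^[ no  _ ] = oneₚ

  ^[]-yes : ∀ {A : Set} (a? : Dec A) p → A → p ^[ a? ] ≋ p
  ^[]-yes (yes _) p _ = ≋-refl
  ^[]-yes (no ¬a) p a = ⊥-elim (¬a a)

  ^[]-no : ∀ {A : Set} (a? : Dec A) p → ¬ A → p ^[ a? ] ≋ oneₚ
  ^[]-no (yes a) p ¬a = ⊥-elim (¬a a)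
  ^[]-no (no _)  p _  = ≋-refl

  ^[]-split : ∀ {A B : Set} (a? : Dec A) (b? : Dec B) p → (A → B) →
              p ^[ b? ] ≋ p ^[ a? ] *ₚ p ^[ b? ×-dec ¬? a? ]
  ^[]-split (yes a) (yes b) p A⇒B = ≋-sym (*ₚ-identityʳ p)
  ^[]-split (yes a) (no ¬b) p A⇒B = ⊥-elim (¬b (A⇒B a))
  ^[]-split (no ¬a) (yes b) p A⇒B = ≋-sym (*ₚ-identityˡ p)
  ^[]-split (no ¬a) (no ¬b) p A⇒B = ≋-sym (*ₚ-identityˡ oneₚ)

  prodₚ-++ : ∀ ps qs → prodₚ (ps ++ qs) ≋ prodₚ ps *ₚ prodₚ qs
  prodₚ-++ []       qs = ≋-sym (*ₚ-identityˡ (prodₚ qs))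
  prodₚ-++ (p ∷ ps) qs = ≋-trans (*ₚ-congˡ p (prodₚ-++ ps qs)) (≋-sym (*ₚ-assoc p (prodₚ ps) (prodₚ qs)))

  module _ {A : Set} where

    prodₚ-map-cong : ∀ {f g : A → Poly} → (∀ x → f x ≋ g x) → ∀ xs → prodₚ (map f xs) ≋ prodₚ (map g xs)
    prodₚ-map-cong f≋g []       = ≋-refl
    prodₚ-map-cong f≋g (x ∷ xs) = *ₚ-cong (f≋g x) (prodₚ-map-cong f≋g xs)

    prodₚ-map-*ₚ : ∀ (f g : A → Poly) xs →
                   prodₚ (map (λ x → f x *ₚ g x) xs) ≋ prodₚ (map f xs) *ₚ prodₚ (map g xs)
    prodₚ-map-*ₚ f g []       = ≋-sym (*ₚ-identityˡ oneₚ)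
    prodₚ-map-*ₚ f g (x ∷ xs) = ≋-trans (*ₚ-congˡ (f x *ₚ g x) (prodₚ-map-*ₚ f g xs))
      (solve 4 (λ a b c d → (a :* b) :* (c :* d) := (a :* c) :* (b :* d)) ≋-refl
               (f x) (g x) (prodₚ (map f xs)) (prodₚ (map g xs)))

    prodₚ-map-filter : ∀ {P : Pred A 0ℓ} (P? : Decidable P) (f : A → Poly) xs →
                       prodₚ (map f (filter P? xs)) ≋ prodₚ (map (λ x → f x ^[ P? x ]) xs)
    prodₚ-map-filter P? f []       = ≋-refl
    prodₚ-map-filter P? f (x ∷ xs) with P? x
    ... | yes _ = *ₚ-congˡ (f x) (prodₚ-map-filter P? f xs)
    ... | no  _ = ≋-trans (prodₚ-map-filter P? f xs) (≋-sym (*ₚ-identityˡ _))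

    prodₚ-map-^[] : ∀ {P : Pred A 0ℓ} (P? : Decidable P) p xs →
                    prodₚ (map (λ x → p ^[ P? x ]) xs) ≋ p ^ₚ length (filter P? xs)
    prodₚ-map-^[] P? p []       = ≋-refl
    prodₚ-map-^[] P? p (x ∷ xs) with P? x
    ... | yes _ = *ₚ-congˡ p (prodₚ-map-^[] P? p xs)
    ... | no  _ = ≋-trans (*ₚ-identityˡ _) (prodₚ-map-^[] P? p xs)

  ∏≤ : ℕ → (ℕ → Poly) → Poly
  ∏≤ N f = prodₚ (map f (range1 N))

  syntax ∏≤ N (λ d → e) = ∏[ d ≤ N ] e

  ∏≤-suc : ∀ f N → ∏≤ (suc N) f ≋ ∏≤ N f *ₚ f (suc N)
  ∏≤-suc f N =
    subst (λ ds → prodₚ (map f ds) ≋ ∏≤ N f *ₚ f (suc N)) (List.applyUpTo-∷ʳ suc N)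
    (subst (λ ps → prodₚ ps ≋ ∏≤ N f *ₚ f (suc N)) (sym (List.map-++ f (range1 N) (suc N ∷ [])))
      (≋-trans (prodₚ-++ (map f (range1 N)) (f (suc N) ∷ [])) (*ₚ-congˡ (∏≤ N f) (*ₚ-identityʳ (f (suc N))))))

  ∏≤-cong : ∀ {f g} N → (∀ d → 1 ≤ d → d ≤ N → f d ≋ g d) → ∏≤ N f ≋ ∏≤ N g
  ∏≤-cong {f} {g} zero    f≋g = ≋-refl
  ∏≤-cong {f} {g} (suc N) f≋g =
    ≋-trans (∏≤-suc f N)
    (≋-trans (*ₚ-cong (∏≤-cong N λ d 1≤d d≤N → f≋g d 1≤d (ℕ.m≤n⇒m≤1+n d≤N))
                      (f≋g (suc N) (s≤s z≤n) ℕ.≤-refl))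
             (≋-sym (∏≤-suc g N)))

  ∏≤-*ₚ : ∀ f g N → ∏[ d ≤ N ] (f d *ₚ g d) ≋ ∏≤ N f *ₚ ∏≤ N g
  ∏≤-*ₚ f g N = prodₚ-map-*ₚ f g (range1 N)

  ∏≤-oneₚ : ∀ N → ∏[ d ≤ N ] oneₚ ≋ oneₚ
  ∏≤-oneₚ zero    = ≋-refl
  ∏≤-oneₚ (suc N) = ≋-trans (∏≤-suc _ N) (≋-trans (*ₚ-identityʳ _) (∏≤-oneₚ N))

  ∏≤-trivial-tail : ∀ f M N → M ≤ N → (∀ d → M < d → d ≤ N → f d ≋ oneₚ) → ∏≤ N f ≋ ∏≤ M f
  ∏≤-trivial-tail f M zero    z≤n _ = ≋-refl
  ∏≤-trivial-tail f M (suc N) M≤1+N trivial with ℕ.m≤n⇒m<n∨m≡n M≤1+N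
  ... | inj₂ refl = ≋-refl
  ... | inj₁ (s≤s M≤N) =
    ≋-trans (∏≤-suc f N)
    (≋-trans (*ₚ-congˡ (∏≤ N f) (trivial (suc N) (s≤s M≤N) ℕ.≤-refl))
    (≋-trans (*ₚ-identityʳ _) (∏≤-trivial-tail f M N M≤N λ d M<d d≤N → trivial d M<d (ℕ.m≤n⇒m≤1+n d≤N))))

  prodₚ-map-∏≤ : ∀ {A : Set} (F : A → ℕ → Poly) N xs →
                 prodₚ (map (λ a → ∏≤ N (F a)) xs) ≋ ∏[ d ≤ N ] prodₚ (map (λ a → F a d) xs)
  prodₚ-map-∏≤ F N []       = ≋-sym (∏≤-oneₚ N)
  prodₚ-map-∏≤ F N (x ∷ xs) =
    ≋-trans (*ₚ-congˡ (∏≤ N (F x)) (prodₚ-map-∏≤ F N xs))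
            (≋-sym (∏≤-*ₚ (F x) (λ d → prodₚ (map (λ a → F a d) xs)) N))

module Cyclotomic where

  open PolyRing
  open Degree
  open Division
  open PolyDivisibility
  open XPowMinusOne
  open Products
  open import Data.Nat as ℕ using (ℕ; zero; suc; _≤_; _<_; z≤n; s≤s; _∸_)
  import Data.Nat.Properties as ℕ
  open import Data.Nat.Divisibility using (_∣_; _∣?_; divides; ∣⇒≤; ∣-trans; ∣-refl)
  open import Data.Nat.GCD using (gcd; gcd[m,n]∣m; gcd[m,n]∣n; gcd[m,n]≢0)
  open import Data.Nat.Induction using (<-rec)
  open import Data.List using ([]; _∷_; _++_; map; filter; length)
  import Data.List.Properties as List
  open import Data.List.Relation.Unary.All.Properties using (applyUpTo⁺₁; filter⁺)
  open import Data.Product using (_,_)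
  open import Data.Sum using (inj₁; inj₂)
  open import Data.Empty using ()
  open import Relation.Binary.PropositionalEquality
  open import Relation.Nullary using (¬_; yes; no; ¬?; _×-dec_)
  import Relation.Binary.Reasoning.Setoid as SetoidReasoning
  open import Algebra.Bundles using (CommutativeRing)

  private
    length-cycloTable : ∀ n → length (cycloTable n) ≡ n
    length-cycloTable zero    = refl
    length-cycloTable (suc n) =
      trans (List.length-++ (cycloTable n)) (trans (cong (ℕ._+ 1) (length-cycloTable n)) (ℕ.+-comm n 1))

    nthₚ-++ˡ : ∀ ps qs k → k < length ps → nthₚ (ps ++ qs) k ≡ nthₚ ps k
    nthₚ-++ˡ (p ∷ ps) qs zero    _         = refl
    nthₚ-++ˡ (p ∷ ps) qs (suc k) (s≤s k<ps) = nthₚ-++ˡ ps qs k k<ps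

    nthₚ-++-length : ∀ ps q qs → nthₚ (ps ++ q ∷ qs) (length ps) ≡ q
    nthₚ-++-length []       q qs = refl
    nthₚ-++-length (p ∷ ps) q qs = nthₚ-++-length ps q qs

    nthₚ-cycloTable : ∀ n d → 1 ≤ d → d ≤ n → nthₚ (cycloTable n) (d ∸ 1) ≡ Φ d
    nthₚ-cycloTable zero    (suc d) _ ()
    nthₚ-cycloTable (suc n) d 1≤d d≤1+n with ℕ.m≤n⇒m<n∨m≡n d≤1+n
    ... | inj₂ refl      = refl
    ... | inj₁ (s≤s d≤n) =
      trans (nthₚ-++ˡ (cycloTable n) _ (d ∸ 1)
              (subst (d ∸ 1 <_) (sym (length-cycloTable n)) (ℕ.<-≤-trans (pred< d 1≤d) d≤n)))
            (nthₚ-cycloTable n d 1≤d d≤n)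
      where
      pred< : ∀ d → 1 ≤ d → d ∸ 1 < d
      pred< (suc d) _ = ℕ.n<1+n d

  Φ-suc : ∀ n → Φ (suc n) ≡ divMonic (xpow-1 (suc n)) (prodₚ (map Φ (filter (_∣? suc n) (range1 n))))
  Φ-suc n =
    trans (subst (λ k → nthₚ (cycloTable (suc n)) k ≡ newest) (length-cycloTable n)
                 (nthₚ-++-length (cycloTable n) newest []))
          (cong (λ ds → divMonic (xpow-1 (suc n)) (prodₚ ds))
                (List.map-cong-local (filter⁺ (_∣? suc n)
                  (applyUpTo⁺₁ suc n λ i<n → nthₚ-cycloTable n _ (s≤s z≤n) i<n))))
    where
    newest = divMonic (xpow-1 (suc n))
               (prodₚ (map (λ d → nthₚ (cycloTable n) (d ∸ 1)) (filter (_∣? suc n) (range1 n))))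

  divisorProduct : ℕ → ℕ → Poly
  divisorProduct m N = ∏[ d ≤ N ] (Φ d ^[ d ∣? m ])

  divisorProduct-≥ : ∀ k N → suc k ≤ N → divisorProduct (suc k) N ≋ divisorProduct (suc k) (suc k)
  divisorProduct-≥ k N k<N = ∏≤-trivial-tail _ (suc k) N k<N λ d k<d _ →
    ^[]-no (d ∣? suc k) (Φ d) λ d∣k → ℕ.<⇒≱ k<d (∣⇒≤ d∣k)

  divisorProduct-suc : ∀ k → divisorProduct (suc k) (suc k) ≋ divisorProduct (suc k) k *ₚ Φ (suc k)
  divisorProduct-suc k = ≋-trans (∏≤-suc _ k) (*ₚ-congˡ (divisorProduct (suc k) k) (^[]-yes (suc k ∣? suc k) _ ∣-refl))

  record Factorisation (m : ℕ) : Set where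
    constructor factorisation
    field
      degree   : ℕ
      monic-Φ  : Monic (Φ m) degree
      xpow-1-≋ : xpow-1 m ≋ divisorProduct m m
  open Factorisation

  module FromSmaller (n : ℕ) (smaller : ∀ d → 1 ≤ d → d ≤ n → Factorisation d) where
    open SetoidReasoning (CommutativeRing.setoid commutativeRing)

    m = suc n

    xpow-1-≋-*Φ : ∀ d → 1 ≤ d → d ≤ n → xpow-1 d ≋ divisorProduct d (d ∸ 1) *ₚ Φ d
    xpow-1-≋-*Φ (suc k) 1≤d d≤n = ≋-trans (xpow-1-≋ (smaller (suc k) 1≤d d≤n)) (divisorProduct-suc k)

    Φ-∣ₚ-xpow-1 : ∀ d → 1 ≤ d → d ≤ n → Φ d ∣ₚ xpow-1 d
    Φ-∣ₚ-xpow-1 d 1≤d d≤n = divisorProduct d (d ∸ 1) , ≋-trans (xpow-1-≋-*Φ d 1≤d d≤n) (*ₚ-comm _ (Φ d))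

    -- The factors Φ x of x^e - 1 with x ∣ g make up x^g - 1; cancelling it from
    -- x^e - 1 = (x^g - 1) geomSum g t leaves Φ e times the remaining factors.
    Φ-∣ₚ-geomSum : ∀ g t → 1 ≤ g → g < t ℕ.* g → t ℕ.* g ≤ n → Φ (t ℕ.* g) ∣ₚ geomSum g t
    Φ-∣ₚ-geomSum (suc g′) t 1≤g g<e e≤n =
      R , ≋-trans (monic-*ₚ-cancelˡ (monic-xpow-1 g′) (geomSum g t) (R *ₚ Φ e) X[g]G≋X[g]RΦ) (*ₚ-comm R (Φ e))
      where
      g = suc g′
      e = t ℕ.* g
      R = ∏[ x ≤ e ∸ 1 ] (Φ x ^[ x ∣? e ×-dec ¬? (x ∣? g) ])
      g≤e∸1 : g ≤ e ∸ 1
      g≤e∸1 = ℕ.m+n≤o⇒m≤o∸n g (subst (_≤ e) (ℕ.+-comm 1 g) g<e)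
      divisors-split : divisorProduct e (e ∸ 1) ≋ xpow-1 g *ₚ R
      divisors-split = begin
        divisorProduct e (e ∸ 1)
          ≈⟨ ∏≤-cong (e ∸ 1) (λ x _ _ →
               ^[]-split (x ∣? g) (x ∣? e) (Φ x) λ x∣g → ∣-trans x∣g (divides t refl)) ⟩
        ∏[ x ≤ e ∸ 1 ] (Φ x ^[ x ∣? g ] *ₚ Φ x ^[ x ∣? e ×-dec ¬? (x ∣? g) ])
          ≈⟨ ∏≤-*ₚ _ _ (e ∸ 1) ⟩
        divisorProduct g (e ∸ 1) *ₚ R
          ≈⟨ *ₚ-congʳ R (divisorProduct-≥ g′ (e ∸ 1) g≤e∸1) ⟩
        divisorProduct g g *ₚ R
          ≈⟨ *ₚ-congʳ R (xpow-1-≋ (smaller g 1≤g (ℕ.≤-trans (ℕ.<⇒≤ g<e) e≤n))) ⟨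
        xpow-1 g *ₚ R ∎
      X[g]G≋X[g]RΦ : xpow-1 g *ₚ geomSum g t ≋ xpow-1 g *ₚ (R *ₚ Φ e)
      X[g]G≋X[g]RΦ = begin
        xpow-1 g *ₚ geomSum g t          ≈⟨ xpow-1-* t g ⟨
        xpow-1 e                         ≈⟨ xpow-1-≋-*Φ e (ℕ.≤-trans 1≤g (ℕ.<⇒≤ g<e)) e≤n ⟩
        divisorProduct e (e ∸ 1) *ₚ Φ e  ≈⟨ *ₚ-congʳ (Φ e) divisors-split ⟩
        xpow-1 g *ₚ R *ₚ Φ e             ≈⟨ *ₚ-assoc (xpow-1 g) R (Φ e) ⟩
        xpow-1 g *ₚ (R *ₚ Φ e)           ∎

    -- With g = gcd d e and e = t g: Φ d divides x^d - 1 and Φ e divides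
    -- geomSum g t, and these two are coprime.
    Φ-coprime : ∀ d e → 1 ≤ d → d < e → e ≤ n → Coprime (Φ d) (Φ e)
    Φ-coprime d e 1≤d d<e e≤n with gcd[m,n]∣m d e | gcd[m,n]∣n d e
    ... | divides s d≡sg | divides t e≡tg =
      Coprime-∣ₚ (Φ-∣ₚ-xpow-1 d 1≤d (ℕ.≤-trans (ℕ.<⇒≤ d<e) e≤n)) Φe∣geomSum
        (subst (λ x → Coprime (xpow-1 x) (geomSum g t)) (sym d≡sg)
               (xpow-1-coprime-geomSum s t 1≤g (subst₂ (λ a b → gcd a b ≡ g) d≡sg e≡tg refl) t≢0))
      where
      g = gcd d e
      d≢0 : ¬ d ≡ 0
      d≢0 refl = ℕ.<-irrefl refl 1≤d
      1≤g : 1 ≤ g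
      1≤g = ℕ.n≢0⇒n>0 (gcd[m,n]≢0 d e (inj₁ d≢0))
      g<e : g < e
      g<e = ℕ.≤-<-trans (∣⇒≤ {{ℕ.≢-nonZero d≢0}} (gcd[m,n]∣m d e)) d<e
      t≢0 : ¬ t ≡ 0
      t≢0 refl = ℕ.<-irrefl (sym e≡tg) (ℕ.<-trans (ℕ.<-≤-trans ℕ.z<s 1≤d) d<e)
      Φe∣geomSum : Φ e ∣ₚ geomSum g t
      Φe∣geomSum = subst (λ x → Φ x ∣ₚ geomSum g t) (sym e≡tg)
        (Φ-∣ₚ-geomSum g t 1≤g (subst (g <_) e≡tg g<e) (subst (_≤ n) e≡tg e≤n))

    divisorProduct-coprime-Φ : ∀ k e → k < e → e ≤ n → Coprime (divisorProduct m k) (Φ e)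
    divisorProduct-coprime-Φ zero    e _   _   = coprime-oneₚ (Φ e)
    divisorProduct-coprime-Φ (suc k) e k<e e≤n =
      Coprime-respˡ-≋ (∏≤-suc _ k) (Coprime-*ₚ (divisorProduct-coprime-Φ k e (ℕ.<-trans (ℕ.n<1+n k) k<e) e≤n) newest)
      where
      newest : Coprime (Φ (suc k) ^[ suc k ∣? m ]) (Φ e)
      newest with suc k ∣? m
      ... | yes _ = Φ-coprime (suc k) e (s≤s z≤n) k<e e≤n
      ... | no  _ = coprime-oneₚ (Φ e)

    record MonicDivisor (P : Poly) : Set where
      constructor monicDivisor
      field
        degree  : ℕ
        monic-P : Monic P degree
        divides-xpow-1 : P ∣ₚ xpow-1 m

    divisorProduct-monicDivisor : ∀ k → k ≤ n → MonicDivisor (divisorProduct m k)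
    divisorProduct-monicDivisor zero _ = monicDivisor 0 monic-oneₚ (xpow-1 m , ≋-sym (*ₚ-identityˡ _))
    divisorProduct-monicDivisor (suc k) k<n
      with divisorProduct-monicDivisor k (ℕ.<⇒≤ k<n) | suc k ∣? m
    ... | monicDivisor δ monic-P P∣X | yes k∣m = monicDivisor (δ ℕ.+ degree Fk)
      (Monic-≋ extend (monic-*ₚ monic-P (monic-Φ Fk)))
      (∣ₚ-respˡ-≋ extend (coprime-monic-∣ₚ monic-P (monic-Φ Fk) P∣X
        (∣ₚ-trans {Φ (suc k)} (Φ-∣ₚ-xpow-1 (suc k) (s≤s z≤n) k<n) (xpow-1-∣ₚ k∣m))
        (divisorProduct-coprime-Φ k (suc k) ℕ.≤-refl k<n)))
      where
      Fk = smaller (suc k) (s≤s z≤n) k<n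
      extend : divisorProduct m (suc k) ≋ divisorProduct m k *ₚ Φ (suc k)
      extend = ≋-trans (∏≤-suc _ k) (*ₚ-congˡ (divisorProduct m k) (^[]-yes (suc k ∣? m) _ k∣m))
    ... | monicDivisor δ monic-P P∣X | no k∤m = monicDivisor δ (Monic-≋ extend monic-P) (∣ₚ-respˡ-≋ extend P∣X)
      where
      extend : divisorProduct m (suc k) ≋ divisorProduct m k
      extend = ≋-trans (∏≤-suc _ k)
        (≋-trans (*ₚ-congˡ (divisorProduct m k) (^[]-no (suc k ∣? m) _ k∤m)) (*ₚ-identityʳ _))

    factorisation-suc : Factorisation m
    factorisation-suc with divisorProduct-monicDivisor n ℕ.≤-refl
    ... | monicDivisor δ monic-P (Y , X≋PY) = factorisation (m ∸ δ) monic-Φm X≋divisorProduct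
      where
      P = prodₚ (map Φ (filter (_∣? m) (range1 n)))
      P≋ : P ≋ divisorProduct m n
      P≋ = prodₚ-map-filter (_∣? m) Φ (range1 n)
      monic-P′ : Monic P δ
      monic-P′ = Monic-≋ P≋ monic-P
      Φm≋Y : Φ m ≋ Y
      Φm≋Y = subst (_≋ Y) (sym (Φ-suc n)) (divMonic-exact Y monic-P′ (≋-trans X≋PY (*ₚ-congʳ Y (≋-sym P≋))))
      X≋divisorProduct : xpow-1 m ≋ divisorProduct m m
      X≋divisorProduct = begin
        xpow-1 m                   ≈⟨ X≋PY ⟩
        divisorProduct m n *ₚ Y    ≈⟨ *ₚ-congˡ (divisorProduct m n) Φm≋Y ⟨
        divisorProduct m n *ₚ Φ m  ≈⟨ divisorProduct-suc n ⟨
        divisorProduct m m         ∎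
      monic-Φm : Monic (Φ m) (m ∸ δ)
      monic-Φm = monic-quotient monic-P′ (Monic-≋ (begin
        P *ₚ Φ m                   ≈⟨ *ₚ-cong P≋ Φm≋Y ⟩
        divisorProduct m n *ₚ Y    ≈⟨ X≋PY ⟨
        xpow-1 m                   ∎) (monic-xpow-1 n))

  factorise : ∀ m → 1 ≤ m → Factorisation m
  factorise = <-rec (λ m → 1 ≤ m → Factorisation m) step
    where
    step : ∀ m → (∀ {d} → d < m → 1 ≤ d → Factorisation d) → 1 ≤ m → Factorisation m
    step (suc n) smaller _ = FromSmaller.factorisation-suc n λ d 1≤d d≤n → smaller (s≤s d≤n) 1≤d

  xpow-1-≋-∏Φ : ∀ g N → 1 ≤ g → g ≤ N → xpow-1 g ≋ ∏[ d ≤ N ] (Φ d ^[ d ∣? g ])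
  xpow-1-≋-∏Φ (suc k) N 1≤g g≤N = ≋-trans (xpow-1-≋ (factorise (suc k) 1≤g)) (≋-sym (divisorProduct-≥ k N g≤N))

module IndicatorSums where

  open import Data.Nat as ℕ using (ℕ; zero; suc; _+_; _*_; _<_; z≤n; s≤s)
  import Data.Nat.Properties as ℕ
  open import Data.Fin using (Fin; toℕ; fromℕ<)
  import Data.Fin.Properties as Fin
  open import Data.Fin.Permutation using (permutation)
  open import Data.List using ([]; _∷_; filter; length; applyUpTo)
  open import Data.Empty using (⊥-elim)
  open import Function using (_∘_; _⇔_; mk⇔; Equivalence)
  open import Relation.Binary.PropositionalEquality
  open import Relation.Nullary using (¬_; Dec; yes; no; _×-dec_)
  open import Relation.Unary using (Pred; Decidable)
  open import Level using (0ℓ)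
  open import Algebra.Properties.Semiring.Sum ℕ.+-*-semiring
    using (sum; sum-permute; ∑-comm; sum-init-last; sum-cong-≗; *-distribˡ-sum)

  𝟙 : ∀ {A : Set} → Dec A → ℕ
  𝟙 (yes _) = 1
  𝟙 (no  _) = 0

  𝟙-cong : ∀ {A B : Set} → A ⇔ B → (a? : Dec A) (b? : Dec B) → 𝟙 a? ≡ 𝟙 b?
  𝟙-cong A⇔B (yes _) (yes _) = refl
  𝟙-cong A⇔B (yes a) (no ¬b) = ⊥-elim (¬b (Equivalence.to A⇔B a))
  𝟙-cong A⇔B (no ¬a) (yes b) = ⊥-elim (¬a (Equivalence.from A⇔B b))
  𝟙-cong A⇔B (no _)  (no _)  = refl

  𝟙-yes : ∀ {A : Set} → A → (a? : Dec A) → 𝟙 a? ≡ 1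
  𝟙-yes a (yes _) = refl
  𝟙-yes a (no ¬a) = ⊥-elim (¬a a)

  𝟙-no : ∀ {A : Set} → ¬ A → (a? : Dec A) → 𝟙 a? ≡ 0
  𝟙-no ¬a (yes a) = ⊥-elim (¬a a)
  𝟙-no ¬a (no _)  = refl

  𝟙-×-dec : ∀ {A B : Set} (a? : Dec A) (b? : Dec B) → 𝟙 (a? ×-dec b?) ≡ 𝟙 a? * 𝟙 b?
  𝟙-×-dec (yes _) (yes _) = refl
  𝟙-×-dec (yes _) (no _)  = refl
  𝟙-×-dec (no _)  (yes _) = refl
  𝟙-×-dec (no _)  (no _)  = refl

  -- Indexed by ℕ rather than Fin n, so that the summation index can be computed with.
  ∑< : ℕ → (ℕ → ℕ) → ℕ
  ∑< n f = sum {n} (f ∘ toℕ)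

  syntax ∑< n (λ i → e) = ∑[ i < n ] e

  ∑<-cong : ∀ n {f g : ℕ → ℕ} → (∀ i → i < n → f i ≡ g i) → ∑< n f ≡ ∑< n g
  ∑<-cong n f≡g = sum-cong-≗ {n} λ i → f≡g (toℕ i) (Fin.toℕ<n i)

  ∑<-last : ∀ n f → ∑< (suc n) f ≡ ∑< n f + f n
  ∑<-last n f = trans (sum-init-last {n} (f ∘ toℕ))
    (cong₂ _+_ (sum-cong-≗ {n} λ i → cong f (Fin.toℕ-inject₁ i)) (cong f (Fin.toℕ-fromℕ n)))

  ∑<-comm : ∀ n m (h : ℕ → ℕ → ℕ) → ∑[ i < n ] ∑< m (h i) ≡ ∑[ j < m ] ∑[ i < n ] h i j
  ∑<-comm n m h = ∑-comm {n} {m} λ i j → h (toℕ i) (toℕ j)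

  ∑<-*ˡ : ∀ n c f → ∑[ i < n ] (c * f i) ≡ c * ∑< n f
  ∑<-*ˡ n c f = sym (*-distribˡ-sum {n} c (f ∘ toℕ))

  ∑<-zero : ∀ n f → (∀ i → i < n → f i ≡ 0) → ∑< n f ≡ 0
  ∑<-zero zero    f _    = refl
  ∑<-zero (suc n) f f≡0 = cong₂ _+_ (f≡0 0 (s≤s z≤n)) (∑<-zero n (f ∘ suc) λ i i<n → f≡0 (suc i) (s≤s i<n))

  ∑<-𝟙-≡ : ∀ d x → x < d → ∑[ r < d ] 𝟙 (x ℕ.≟ r) ≡ 1
  ∑<-𝟙-≡ (suc d) zero    _         = cong suc (∑<-zero d _ λ i _ → 𝟙-no (λ ()) (0 ℕ.≟ suc i))
  ∑<-𝟙-≡ (suc d) (suc x) (s≤s x<d) =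
    trans (cong (_+ ∑[ r < d ] 𝟙 (suc x ℕ.≟ suc r)) (𝟙-no (λ ()) (suc x ℕ.≟ 0)))
          (trans (∑<-cong d λ r _ → 𝟙-cong (mk⇔ ℕ.suc-injective (cong suc)) (suc x ℕ.≟ suc r) (x ℕ.≟ r))
                 (∑<-𝟙-≡ d x x<d))

  ∑<-permute : ∀ n (σ τ : ℕ → ℕ) → (∀ i → i < n → σ i < n) → (∀ i → i < n → τ i < n) →
               (∀ i → i < n → σ (τ i) ≡ i) → (∀ i → i < n → τ (σ i) ≡ i) →
               ∀ f → ∑[ i < n ] f (σ i) ≡ ∑< n f
  ∑<-permute n σ τ σ< τ< στ τσ f =
    sym (trans (sum-permute {n} {n} (f ∘ toℕ) π)
               (sum-cong-≗ {n} λ i → cong f (Fin.toℕ-fromℕ< (σ< (toℕ i) (Fin.toℕ<n i)))))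
    where
    σ′ τ′ : Fin n → Fin n
    σ′ i = fromℕ< (σ< (toℕ i) (Fin.toℕ<n i))
    τ′ i = fromℕ< (τ< (toℕ i) (Fin.toℕ<n i))
    π = permutation σ′ τ′
      (λ i → Fin.toℕ-injective
        (trans (Fin.toℕ-fromℕ< _) (trans (cong σ (Fin.toℕ-fromℕ< _)) (στ (toℕ i) (Fin.toℕ<n i)))))
      (λ i → Fin.toℕ-injective
        (trans (Fin.toℕ-fromℕ< _) (trans (cong τ (Fin.toℕ-fromℕ< _)) (τσ (toℕ i) (Fin.toℕ<n i)))))

  length-filter-applyUpTo : ∀ {P : Pred ℕ 0ℓ} (P? : Decidable P) g n →
                            length (filter P? (applyUpTo g n)) ≡ ∑[ i < n ] 𝟙 (P? (g i))
  length-filter-applyUpTo P? g zero = refl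
  length-filter-applyUpTo P? g (suc n) with P? (g 0)
  ... | yes _ = cong suc (length-filter-applyUpTo P? (g ∘ suc) n)
  ... | no  _ = length-filter-applyUpTo P? (g ∘ suc) n

  -- Counting over 1, …, n instead of 0, …, n - 1 replaces n by 0.
  length-filter-range1 : ∀ {P : Pred ℕ 0ℓ} (P? : Decidable P) n → P n ⇔ P 0 →
                         length (filter P? (range1 n)) ≡ ∑[ a < n ] 𝟙 (P? a)
  length-filter-range1 P? n Pn⇔P0 = trans (length-filter-applyUpTo P? suc n)
    (ℕ.+-cancelˡ-≡ (𝟙 (P? 0)) _ _ (begin
      𝟙 (P? 0) + ∑[ a < n ] 𝟙 (P? (suc a)) ≡⟨ ∑<-last n (𝟙 ∘ P?) ⟩
      ∑[ a < n ] 𝟙 (P? a) + 𝟙 (P? n)       ≡⟨ cong (∑[ a < n ] 𝟙 (P? a) +_) (𝟙-cong Pn⇔P0 (P? n) (P? 0)) ⟩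
      ∑[ a < n ] 𝟙 (P? a) + 𝟙 (P? 0)       ≡⟨ ℕ.+-comm _ (𝟙 (P? 0)) ⟩
      𝟙 (P? 0) + ∑[ a < n ] 𝟙 (P? a)       ∎))
    where open ≡-Reasoning

  length-filter-filter : ∀ {A : Set} {P Q : Pred A 0ℓ} (P? : Decidable P) (Q? : Decidable Q) xs →
                         length (filter Q? (filter P? xs)) ≡ length (filter (λ a → P? a ×-dec Q? a) xs)
  length-filter-filter P? Q? [] = refl
  length-filter-filter P? Q? (x ∷ xs) with P? x
  ... | no  _ = length-filter-filter P? Q? xs
  ... | yes _ with Q? x
  ...   | yes _ = cong suc (length-filter-filter P? Q? xs)
  ...   | no  _ = length-filter-filter P? Q? xs

module ModularArithmetic where

  open import Data.Nat as ℕ using (ℕ; _+_; _*_; _∸_; _≤_; NonZero)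
  import Data.Nat.Properties as ℕ
  open import Data.Nat.DivMod
  open import Data.Nat.Divisibility
  open import Data.Nat.GCD
  open import Data.Nat.Coprimality using (coprime-Bézout; coprime-factors; gcd≡1⇒coprime)
  open import Data.Nat.Primality using (Prime; euclidsLemma; ¬prime[1])
  open import Data.Nat.Primality.Factorisation using (factorise; factorisationHasAllPrimeFactors; PrimeFactorisation)
  open import Data.Nat.ListAction using (product)
  open import Data.Nat.ListAction.Properties using (∈⇒∣product)
  open import Data.Nat.Solver using (module +-*-Solver)
  open import Data.List using ([]; _∷_; filter)
  open import Data.List.Relation.Unary.All using (All; _∷_)
  open import Data.List.Relation.Unary.All.Properties using (filter⁺)
  open import Data.List.Relation.Unary.Any using (here)
  open import Data.List.Membership.Propositional.Properties using (∈-filter⁺; ∈-filter⁻)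
  open import Data.Product using (Σ; _×_; _,_; proj₂)
  open import Data.Sum using (inj₁; inj₂)
  open import Data.Empty using (⊥; ⊥-elim)
  open import Relation.Binary.PropositionalEquality
  open import Relation.Nullary using (¬_; yes; no; ¬?)

  %-*ˡ : ∀ x y n .{{_ : NonZero n}} → ((x % n) * y) % n ≡ (x * y) % n
  %-*ˡ x y n = begin
    ((x % n) * y) % n             ≡⟨ %-distribˡ-* (x % n) y n ⟩
    ((x % n % n) * (y % n)) % n   ≡⟨ cong (λ z → (z * (y % n)) % n) (m%n%n≡m%n x n) ⟩
    ((x % n) * (y % n)) % n       ≡⟨ %-distribˡ-* x y n ⟨
    (x * y) % n                   ∎
    where open ≡-Reasoning

  %-*ʳ : ∀ x y n .{{_ : NonZero n}} → (x * (y % n)) % n ≡ (x * y) % n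
  %-*ʳ x y n = trans (cong (_% n) (ℕ.*-comm x (y % n))) (trans (%-*ˡ y x n) (cong (_% n) (ℕ.*-comm y x)))

  %≡⇒∣∸ : ∀ x y d .{{_ : NonZero d}} → y ≤ x → x % d ≡ y % d → d ∣ x ∸ y
  %≡⇒∣∸ x y d y≤x x≡y = divides (x / d ∸ y / d) (begin
    x ∸ y                                       ≡⟨ cong₂ _∸_ (m≡m%n+[m/n]*n x d) (m≡m%n+[m/n]*n y d) ⟩
    (x % d + x / d * d) ∸ (y % d + y / d * d)   ≡⟨ cong (λ z → (z + x / d * d) ∸ (y % d + y / d * d)) x≡y ⟩
    (y % d + x / d * d) ∸ (y % d + y / d * d)   ≡⟨ ℕ.[m+n]∸[m+o]≡n∸o (y % d) _ _ ⟩
    x / d * d ∸ y / d * d                       ≡⟨ ℕ.*-distribʳ-∸ d (x / d) (y / d) ⟨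
    (x / d ∸ y / d) * d                         ∎)
    where open ≡-Reasoning

  gcd-% : ∀ a n .{{_ : NonZero n}} → gcd (a % n) n ≡ gcd a n
  gcd-% a n = ∣-antisym
    (gcd-greatest (∣n∣m%n⇒∣m (gcd[m,n]∣n (a % n) n) (gcd[m,n]∣m (a % n) n)) (gcd[m,n]∣n (a % n) n))
    (gcd-greatest (%-presˡ-∣ (gcd[m,n]∣m a n) (gcd[m,n]∣n a n)) (gcd[m,n]∣n a n))

  gcd-*-coprimeˡ : ∀ u a n → gcd u n ≡ 1 → gcd (u * a) n ≡ gcd a n
  gcd-*-coprimeˡ u a n u⊥n = ∣-antisym
    (gcd-greatest (coprime-factors {o = a} (gcd≡1⇒coprime {u} {n} u⊥n)
                                  (gcd[m,n]∣m (u * a) n , ∣m⇒∣m*n a (gcd[m,n]∣n (u * a) n)))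
                  (gcd[m,n]∣n (u * a) n))
    (gcd-greatest (∣n⇒∣m*n u (gcd[m,n]∣m a n)) (gcd[m,n]∣n a n))

  gcd≡1-∣ʳ : ∀ a {d n} → d ∣ n → gcd a n ≡ 1 → gcd a d ≡ 1
  gcd≡1-∣ʳ a {d} d∣n a⊥n =
    ∣1⇒≡1 (subst (gcd a d ∣_) a⊥n (gcd-greatest (gcd[m,n]∣m a d) (∣-trans (gcd[m,n]∣n a d) d∣n)))

  -- From the Bézout identity 1 + x u = y n, the inverse is x² u, since (x u)² ≡ (-1)² = 1.
  modular-inverse : ∀ u n .{{_ : NonZero n}} → gcd u n ≡ 1 → Σ ℕ λ v → (v * u) % n ≡ 1 % n
  modular-inverse u n u⊥n with coprime-Bézout (gcd≡1⇒coprime {u} {n} u⊥n)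
  ... | Bézout.+- x y 1+yn≡xu = x , (begin
    (x * u) % n           ≡⟨ cong (_% n) 1+yn≡xu ⟨
    (1 + y * n) % n       ≡⟨ [m+kn]%n≡m%n 1 y n ⟩
    1 % n                 ∎)
    where open ≡-Reasoning
  ... | Bézout.-+ x y 1+xu≡yn = x * x * u , (begin
    (x * x * u * u) % n
      ≡⟨ cong (_% n) (solve 3 (λ x u n → x :* x :* u :* u := (x :* u) :* (x :* u)) refl x u n) ⟩
    (w * w) % n
      ≡⟨ [m+kn]%n≡m%n (w * w) (2 * y) n ⟨
    (w * w + 2 * y * n) % n
      ≡⟨ cong (_% n) square ⟩
    (1 + y * y * n * n) % n
      ≡⟨ [m+kn]%n≡m%n 1 (y * y * n) n ⟩
    1 % n ∎)
    where
    open ≡-Reasoning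
    open +-*-Solver
    w = x * u
    square : w * w + 2 * y * n ≡ 1 + y * y * n * n
    square = begin
      w * w + 2 * y * n
        ≡⟨ solve 3 (λ w y n → w :* w :+ con 2 :* y :* n := w :* w :+ con 2 :* (y :* n)) refl w y n ⟩
      w * w + 2 * (y * n)
        ≡⟨ cong (λ z → w * w + 2 * z) 1+xu≡yn ⟨
      w * w + 2 * (1 + w)
        ≡⟨ solve 1 (λ w → w :* w :+ con 2 :* (con 1 :+ w) := con 1 :+ (con 1 :+ w) :* (con 1 :+ w)) refl w ⟩
      1 + (1 + w) * (1 + w)
        ≡⟨ cong (λ z → 1 + z * z) 1+xu≡yn ⟩
      1 + (y * n) * (y * n)
        ≡⟨ solve 2 (λ y n → con 1 :+ (y :* n) :* (y :* n) := con 1 :+ y :* y :* n :* n) refl y n ⟩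
      1 + y * y * n * n ∎

  private
    prime-factor : ∀ g .{{_ : NonZero g}} → ¬ g ≡ 1 → Σ ℕ λ q → Prime q × q ∣ g
    prime-factor g g≢1 with factorise g
    ... | record { factors = [] ; isFactorisation = g≡1 } = ⊥-elim (g≢1 g≡1)
    ... | record { factors = q ∷ qs ; isFactorisation = g≡∏ ; factorsPrime = q-prime ∷ _ } =
      q , q-prime , subst (q ∣_) (sym g≡∏) (∈⇒∣product {ns = q ∷ qs} (here refl))

  -- Every unit r modulo a divisor d of n lifts to a unit modulo n: take
  -- u = r + d t, with t the product of the prime factors of n not dividing r.
  lift-unit : ∀ r d n .{{_ : NonZero n}} .{{_ : NonZero d}} → d ∣ n → gcd r d ≡ 1 →
              Σ ℕ λ u → gcd u n ≡ 1 × u % d ≡ r % d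
  lift-unit r d n d∣n r⊥d = u , u⊥n , %-remove-+ʳ r (divides t (ℕ.*-comm d t))
    where
    F = factorise n
    fs = PrimeFactorisation.factors F
    avoid-r = λ p → ¬? (p ∣? r)
    t = product (filter avoid-r fs)
    u = r + d * t
    filter-prime : All Prime (filter avoid-r fs)
    filter-prime = filter⁺ avoid-r (PrimeFactorisation.factorsPrime F)
    no-common-prime : ∀ q → Prime q → q ∣ u → q ∣ n → ⊥
    no-common-prime q q-prime q∣u q∣n with q ∣? r
    ... | yes q∣r with euclidsLemma d t q-prime (∣m+n∣m⇒∣n q∣u q∣r)
    ...   | inj₁ q∣d = ¬prime[1] (subst Prime (∣1⇒≡1 (subst (q ∣_) r⊥d (gcd-greatest q∣r q∣d))) q-prime)
    ...   | inj₂ q∣t = proj₂ (∈-filter⁻ avoid-r {xs = fs} (factorisationHasAllPrimeFactors q-prime q∣t filter-prime)) q∣r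
    no-common-prime q q-prime q∣u q∣n | no q∤r =
      q∤r (∣m+n∣m⇒∣n (subst (q ∣_) (ℕ.+-comm r (d * t)) q∣u) (∣n⇒∣m*n d q∣t))
      where
      q∈fs = factorisationHasAllPrimeFactors q-prime (subst (q ∣_) (PrimeFactorisation.isFactorisation F) q∣n)
                                             (PrimeFactorisation.factorsPrime F)
      q∣t : q ∣ t
      q∣t = ∈⇒∣product (∈-filter⁺ avoid-r q∈fs q∤r)
    u⊥n : gcd u n ≡ 1
    u⊥n with gcd u n ℕ.≟ 1
    ... | yes u⊥n = u⊥n
    ... | no  g≢1 with prime-factor (gcd u n) {{ℕ.≢-nonZero λ g≡0 → ℕ.≢-nonZero⁻¹ n (gcd[m,n]≡0⇒n≡0 u g≡0)}} g≢1
    ...   | q , q-prime , q∣g =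
      ⊥-elim (no-common-prime q q-prime (∣-trans q∣g (gcd[m,n]∣m u n)) (∣-trans q∣g (gcd[m,n]∣n u n)))

module Totient where

  open IndicatorSums
  open ModularArithmetic
  open import Data.Nat as ℕ using (ℕ; zero; suc; _+_; _*_; _∸_; _≤_; _<_; z≤n; s≤s; NonZero)
  import Data.Nat.Properties as ℕ
  open import Data.Nat.DivMod using (_%_; m%n<n; m<n⇒m%n≡m; m∣n⇒o%n%m≡o%m; %-remove-+ʳ; m*n/n≡m)
  open import Data.Nat.Divisibility using (_∣_; _∣?_; ∣-antisym; ∣-trans; ∣-refl; ∣1⇒≡1; 1∣_; 0∣⇒≡0)
  open import Data.Nat.GCD using (gcd; gcd[m,n]∣m; gcd-greatest; gcd-identityˡ; gcd-zeroˡ)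
  open import Data.List using (filter; length)
  open import Data.Product using (_×_; _,_)
  open import Data.Empty using (⊥-elim)
  open import Function using (_⇔_; mk⇔)
  open import Relation.Binary.PropositionalEquality
  open import Relation.Nullary using (¬_; Dec; yes; no; _×-dec_)

  private
    gcd[0,n]≡gcd[n,n] : ∀ n → gcd 0 n ≡ gcd n n
    gcd[0,n]≡gcd[n,n] n = trans (gcd-identityˡ n) (∣-antisym (gcd-greatest ∣-refl ∣-refl) (gcd[m,n]∣m n n))

  φ-as-∑ : ∀ n → φ n ≡ ∑[ a < n ] 𝟙 (gcd a n ℕ.≟ 1)
  φ-as-∑ n = length-filter-range1 (λ a → gcd a n ℕ.≟ 1) n
    (mk⇔ (trans (gcd[0,n]≡gcd[n,n] n)) (trans (sym (gcd[0,n]≡gcd[n,n] n))))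

  φ-pos : ∀ d → 0 < φ (suc d)
  φ-pos d = subst (0 <_) (sym φ≡suc) (s≤s z≤n)
    where
    unit? = λ a → gcd a (suc d) ℕ.≟ 1
    φ≡suc : φ (suc d) ≡ suc (∑[ i < d ] 𝟙 (unit? (suc (suc i))))
    φ≡suc = trans (length-filter-applyUpTo unit? suc (suc d))
                  (cong (_+ ∑[ i < d ] 𝟙 (unit? (suc (suc i)))) (𝟙-yes (gcd-zeroˡ (suc d)) (unit? 1)))

  *-div-cancel : ∀ c m .{{_ : NonZero m}} → (c * m) div m ≡ c
  *-div-cancel c (suc k) = m*n/n≡m c (suc k)

  private
    %-*-inverse : ∀ x y b n .{{_ : NonZero n}} → (x * y) % n ≡ 1 % n → b < n → (x * ((y * b) % n)) % n ≡ b
    %-*-inverse x y b n xy≡1 b<n = begin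
      (x * ((y * b) % n)) % n   ≡⟨ %-*ʳ x (y * b) n ⟩
      (x * (y * b)) % n         ≡⟨ cong (_% n) (ℕ.*-assoc x y b) ⟨
      (x * y * b) % n           ≡⟨ %-*ˡ (x * y) b n ⟨
      ((x * y) % n * b) % n     ≡⟨ cong (λ z → (z * b) % n) xy≡1 ⟩
      ((1 % n) * b) % n         ≡⟨ %-*ˡ 1 b n ⟩
      (1 * b) % n               ≡⟨ cong (_% n) (ℕ.*-identityˡ b) ⟩
      b % n                     ≡⟨ m<n⇒m%n≡m b<n ⟩
      b                         ∎
      where open ≡-Reasoning

  -- The units modulo n are counted by their residues r modulo d ∣ n.  Every unit
  -- residue r is hit equally often: multiplication by a unit u ≡ r (mod d)
  -- permutes the units modulo n and moves the residue 1 to r.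
  module UnitResidues (n′ d′ : ℕ) (d∣n : suc d′ ∣ suc n′) where
    private
      n = suc n′
      d = suc d′

      %n%d : ∀ x → x % n % d ≡ x % d
      %n%d x = m∣n⇒o%n%m≡o%m d n x d∣n

    unit? : ∀ a → Dec (gcd a n ≡ 1)
    unit? a = gcd a n ℕ.≟ 1

    unitsIn : ℕ → ℕ
    unitsIn r = ∑[ a < n ] (𝟙 (unit? a) * 𝟙 (a % d ℕ.≟ r))

    φ-≡-∑-unitsIn : φ n ≡ ∑[ r < d ] unitsIn r
    φ-≡-∑-unitsIn = begin
      φ n
        ≡⟨ φ-as-∑ n ⟩
      ∑[ a < n ] 𝟙 (unit? a)
        ≡⟨ ∑<-cong n (λ a _ → sym (one-residue a)) ⟩
      ∑[ a < n ] ∑[ r < d ] (𝟙 (unit? a) * 𝟙 (a % d ℕ.≟ r))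
        ≡⟨ ∑<-comm n d (λ a r → 𝟙 (unit? a) * 𝟙 (a % d ℕ.≟ r)) ⟩
      ∑[ r < d ] unitsIn r ∎
      where
      open ≡-Reasoning
      one-residue : ∀ a → ∑[ r < d ] (𝟙 (unit? a) * 𝟙 (a % d ℕ.≟ r)) ≡ 𝟙 (unit? a)
      one-residue a = trans (∑<-*ˡ d (𝟙 (unit? a)) (λ r → 𝟙 (a % d ℕ.≟ r)))
        (trans (cong (𝟙 (unit? a) *_) (∑<-𝟙-≡ d (a % d) (m%n<n a d))) (ℕ.*-identityʳ _))

    unitsIn-nonUnit : ∀ r → ¬ gcd r d ≡ 1 → unitsIn r ≡ 0
    unitsIn-nonUnit r r̸⊥d = ∑<-zero n (λ a → 𝟙 (unit? a) * 𝟙 (a % d ℕ.≟ r)) λ a _ → vanishes a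
      where
      vanishes : ∀ a → 𝟙 (unit? a) * 𝟙 (a % d ℕ.≟ r) ≡ 0
      vanishes a with unit? a | a % d ℕ.≟ r
      ... | no  _   | _       = refl
      ... | yes _   | no  _   = refl
      ... | yes a⊥n | yes a≡r =
        ⊥-elim (r̸⊥d (trans (cong (λ z → gcd z d) (sym a≡r)) (trans (gcd-% a d) (gcd≡1-∣ʳ a d∣n a⊥n))))

    module Translation (r u v : ℕ) (r<d : r < d) (u⊥n : gcd u n ≡ 1) (vu≡1 : (v * u) % n ≡ 1 % n)
                       (u≡r : u % d ≡ r % d) where
      σ τ : ℕ → ℕ
      σ a = (u * a) % n
      τ b = (v * b) % n

      private
        vu≡1-mod-d : (v * u) % d ≡ 1 % d
        vu≡1-mod-d = trans (sym (%n%d (v * u))) (trans (cong (_% d) vu≡1) (%n%d 1))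

        u≡r′ : u % d ≡ r
        u≡r′ = trans u≡r (m<n⇒m%n≡m r<d)

      σ-unit : ∀ a → gcd (σ a) n ≡ gcd a n
      σ-unit a = trans (gcd-% (u * a) n) (gcd-*-coprimeˡ u a n u⊥n)

      σ-residue : ∀ a → σ a % d ≡ r ⇔ a % d ≡ 1 % d
      σ-residue a = mk⇔ to from
        where
        open ≡-Reasoning
        to : σ a % d ≡ r → a % d ≡ 1 % d
        to σa≡r = begin
          a % d
            ≡⟨ cong (_% d) (ℕ.*-identityˡ a) ⟨
          (1 * a) % d
            ≡⟨ %-*ˡ 1 a d ⟨
          ((1 % d) * a) % d
            ≡⟨ cong (λ z → (z * a) % d) vu≡1-mod-d ⟨
          ((v * u) % d * a) % d
            ≡⟨ %-*ˡ (v * u) a d ⟩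
          (v * u * a) % d
            ≡⟨ cong (_% d) (ℕ.*-assoc v u a) ⟩
          (v * (u * a)) % d
            ≡⟨ %-*ʳ v (u * a) d ⟨
          (v * ((u * a) % d)) % d
            ≡⟨ cong (λ z → (v * z) % d) (trans (sym (%n%d (u * a))) (trans σa≡r (sym u≡r′))) ⟩
          (v * (u % d)) % d
            ≡⟨ %-*ʳ v u d ⟩
          (v * u) % d
            ≡⟨ vu≡1-mod-d ⟩
          1 % d ∎
        from : a % d ≡ 1 % d → σ a % d ≡ r
        from a≡1 = begin
          (u * a) % n % d            ≡⟨ %n%d (u * a) ⟩
          (u * a) % d                ≡⟨ %-*ʳ u a d ⟨
          (u * (a % d)) % d          ≡⟨ cong (λ z → (u * z) % d) a≡1 ⟩
          (u * (1 % d)) % d          ≡⟨ %-*ʳ u 1 d ⟩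
          (u * 1) % d                ≡⟨ cong (_% d) (ℕ.*-identityʳ u) ⟩
          u % d                      ≡⟨ u≡r′ ⟩
          r                          ∎

      unitsIn-≡ : unitsIn r ≡ unitsIn (1 % d)
      unitsIn-≡ = trans (sym (∑<-permute n σ τ (λ a _ → m%n<n (u * a) n) (λ b _ → m%n<n (v * b) n)
                                         (λ b → %-*-inverse u v b n (trans (cong (_% n) (ℕ.*-comm u v)) vu≡1))
                                         (λ a → %-*-inverse v u a n vu≡1)
                                         (λ a → 𝟙 (unit? a) * 𝟙 (a % d ℕ.≟ r))))
                        (∑<-cong n λ a _ → cong₂ _*_
                          (𝟙-cong (mk⇔ (trans (sym (σ-unit a))) (trans (σ-unit a))) (unit? (σ a)) (unit? a))
                          (𝟙-cong (σ-residue a) (σ a % d ℕ.≟ r) (a % d ℕ.≟ 1 % d)))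

    unitsIn-unit : ∀ r → r < d → gcd r d ≡ 1 → unitsIn r ≡ unitsIn (1 % d)
    unitsIn-unit r r<d r⊥d with lift-unit r d n d∣n r⊥d
    ... | u , u⊥n , u≡r with modular-inverse u n u⊥n
    ...   | v , vu≡1 = Translation.unitsIn-≡ r u v r<d u⊥n vu≡1 u≡r

    φ-≡-unitsIn-*-φ : φ n ≡ unitsIn (1 % d) * φ d
    φ-≡-unitsIn-*-φ = begin
      φ n
        ≡⟨ φ-≡-∑-unitsIn ⟩
      ∑[ r < d ] unitsIn r
        ≡⟨ ∑<-cong d (λ r r<d → by-residue r r<d (gcd r d ℕ.≟ 1)) ⟩
      ∑[ r < d ] (unitsIn (1 % d) * 𝟙 (gcd r d ℕ.≟ 1))
        ≡⟨ ∑<-*ˡ d (unitsIn (1 % d)) (λ r → 𝟙 (gcd r d ℕ.≟ 1)) ⟩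
      unitsIn (1 % d) * ∑[ r < d ] 𝟙 (gcd r d ℕ.≟ 1)
        ≡⟨ cong (unitsIn (1 % d) *_) (φ-as-∑ d) ⟨
      unitsIn (1 % d) * φ d ∎
      where
      open ≡-Reasoning
      by-residue : ∀ r → r < d → (r⊥d? : Dec (gcd r d ≡ 1)) → unitsIn r ≡ unitsIn (1 % d) * 𝟙 r⊥d?
      by-residue r r<d (yes r⊥d) = trans (unitsIn-unit r r<d r⊥d) (sym (ℕ.*-identityʳ _))
      by-residue r r<d (no  r̸⊥d) = trans (unitsIn-nonUnit r r̸⊥d) (sym (ℕ.*-zeroʳ (unitsIn (1 % d))))

    -- For a ≥ 1, d divides gcd (a - 1, n) iff a ≡ 1 (mod d); for a = 0 both
    -- hold once a is a unit, as then n = 1.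
    count-≡-unitsIn : length (filter (λ a → d ∣? gcd (a ∸ 1) n) (filter unit? (range1 n))) ≡ unitsIn (1 % d)
    count-≡-unitsIn =
      trans (length-filter-filter unit? (λ a → d ∣? gcd (a ∸ 1) n) (range1 n))
      (trans (length-filter-range1 P? n (mk⇔ Pn⇒P0 P0⇒Pn))
             (∑<-cong n λ a _ → trans (𝟙-cong (P⇔unit×≡1 a) (P? a) (unit? a ×-dec (a % d ℕ.≟ 1 % d)))
                                      (𝟙-×-dec (unit? a) (a % d ℕ.≟ 1 % d))))
      where
      P? = λ a → unit? a ×-dec d ∣? gcd (a ∸ 1) n
      d≡1 : gcd 0 n ≡ 1 → d ≡ 1
      d≡1 0⊥n = ∣1⇒≡1 (subst (d ∣_) (trans (sym (gcd-identityˡ n)) 0⊥n) d∣n)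
      d∣any : gcd 0 n ≡ 1 → ∀ {x} → d ∣ x
      d∣any 0⊥n {x} = subst (_∣ x) (sym (d≡1 0⊥n)) (1∣ x)
      residue-0 : gcd 0 n ≡ 1 → 0 % d ≡ 1 % d
      residue-0 0⊥n with d≡1 0⊥n
      ... | refl = refl
      Pn⇒P0 : gcd n n ≡ 1 × d ∣ gcd (n ∸ 1) n → gcd 0 n ≡ 1 × d ∣ gcd 0 n
      Pn⇒P0 (n⊥n , _) = trans (gcd[0,n]≡gcd[n,n] n) n⊥n , subst (d ∣_) (sym (gcd-identityˡ n)) d∣n
      P0⇒Pn : gcd 0 n ≡ 1 × d ∣ gcd 0 n → gcd n n ≡ 1 × d ∣ gcd (n ∸ 1) n
      P0⇒Pn (0⊥n , _) = trans (sym (gcd[0,n]≡gcd[n,n] n)) 0⊥n , d∣any 0⊥n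
      P⇔unit×≡1 : ∀ a → (gcd a n ≡ 1 × d ∣ gcd (a ∸ 1) n) ⇔ (gcd a n ≡ 1 × a % d ≡ 1 % d)
      P⇔unit×≡1 zero = mk⇔ (λ (0⊥n , _) → 0⊥n , residue-0 0⊥n) (λ (0⊥n , _) → 0⊥n , d∣any 0⊥n)
      P⇔unit×≡1 (suc a) = mk⇔
        (λ (a⊥n , d∣gcd) → a⊥n , %-remove-+ʳ 1 (∣-trans d∣gcd (gcd[m,n]∣m a n)))
        (λ (a⊥n , a≡1) → a⊥n , gcd-greatest (%≡⇒∣∸ (suc a) 1 d (s≤s z≤n) a≡1) d∣n)

  count-units-≡1 : ∀ n → 1 ≤ n → ∀ d → d ∣ n →
    length (filter (λ a → d ∣? gcd (a ∸ 1) n) (filter (λ a → gcd a n ℕ.≟ 1) (range1 n))) ≡ φ n div φ d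
  count-units-≡1 (suc n′) _ zero     0∣n = ⊥-elim (ℕ.0≢1+n (sym (0∣⇒≡0 0∣n)))
  count-units-≡1 (suc n′) _ (suc d′) d∣n = begin
    length (filter (λ a → suc d′ ∣? gcd (a ∸ 1) (suc n′)) (filter unit? (range1 (suc n′))))
                                            ≡⟨ count-≡-unitsIn ⟩
    C                                       ≡⟨ *-div-cancel C (φ (suc d′)) {{ℕ.>-nonZero (φ-pos d′)}} ⟨
    (C * φ (suc d′)) div φ (suc d′)         ≡⟨ cong (_div φ (suc d′)) φ-≡-unitsIn-*-φ ⟨
    φ (suc n′) div φ (suc d′)               ∎
    where
    open ≡-Reasoning
    open UnitResidues n′ d′ d∣n
    C = unitsIn (1 % suc d′)

open PolyRing
open Products
open Cyclotomic
open Totient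
import Data.Nat as ℕ
import Data.Nat.Properties as ℕ
open import Data.Nat.Divisibility using (_∣_; ∣⇒≤; ∣-trans)
open import Data.Nat.GCD using (gcd[m,n]∣n; gcd[m,n]≢0)
open import Data.List using (List; length)
import Data.List.Properties as List
open import Data.List.Relation.Unary.All using (universal)
open import Data.Sum using (inj₂)
open import Relation.Binary.PropositionalEquality using (_≡_; refl; cong)
open import Relation.Nullary using (¬_; Dec; yes; no)
import Relation.Binary.Reasoning.Setoid as SetoidReasoning
open import Algebra.Bundles using (CommutativeRing)

units : ℕ → List ℕ
units n = filter (λ a → gcd a n ≟ 1) (range1 n)

module _ (n : ℕ) (1≤n : 1 ≤ n) where
  private
    n≢0 : ¬ n ≡ 0
    n≢0 refl = ℕ.<-irrefl refl 1≤n

  xpow-1-gcd-≋ : ∀ a → xpow-1 (gcd (a ∸ 1) n) ≋ ∏[ d ≤ n ] (Φ d ^[ d ∣? gcd (a ∸ 1) n ])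
  xpow-1-gcd-≋ a = xpow-1-≋-∏Φ (gcd (a ∸ 1) n) n
    (ℕ.n≢0⇒n>0 (gcd[m,n]≢0 (a ∸ 1) n (inj₂ n≢0)))
    (∣⇒≤ {{ℕ.≢-nonZero n≢0}} (gcd[m,n]∣n (a ∸ 1) n))

  multiplicity-Φ : ∀ d → prodₚ (map (λ a → Φ d ^[ d ∣? gcd (a ∸ 1) n ]) (units n))
                           ≋ (Φ d ^ₚ (φ n div φ d)) ^[ d ∣? n ]
  multiplicity-Φ d =
    ≋-trans (prodₚ-map-^[] (λ a → d ∣? gcd (a ∸ 1) n) (Φ d) (units n)) (by-divisibility (d ∣? n))
    where
    by-divisibility : (d∣n? : Dec (d ∣ n)) →
                      Φ d ^ₚ length (filter (λ a → d ∣? gcd (a ∸ 1) n) (units n))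
                        ≋ (Φ d ^ₚ (φ n div φ d)) ^[ d∣n? ]
    by-divisibility (yes d∣n) = ≡⇒≋ (cong (Φ d ^ₚ_) (count-units-≡1 n 1≤n d d∣n))
    by-divisibility (no  d∤n) = ≡⇒≋ (cong (λ as → Φ d ^ₚ length as)
      (List.filter-none (λ a → d ∣? gcd (a ∸ 1) n)
        (universal (λ a d∣g → d∤n (∣-trans d∣g (gcd[m,n]∣n (a ∸ 1) n))) (units n))))

mainTheorem7 : (n : ℕ) → 1 ≤ n →
    prodₚ (map (λ a → xpow-1 (gcd (a ∸ 1) n)) (filter (λ a → gcd a n ≟ 1) (range1 n)))
      ≈ₚ prodₚ (map (λ d → Φ d ^ₚ (φ n div φ d)) (filter (λ d → d ∣? n) (range1 n)))
mainTheorem7 n 1≤n = coeff-≡ (begin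
  prodₚ (map (λ a → xpow-1 (gcd (a ∸ 1) n)) (units n))
    ≈⟨ prodₚ-map-cong (xpow-1-gcd-≋ n 1≤n) (units n) ⟩
  prodₚ (map (λ a → ∏[ d ≤ n ] (Φ d ^[ d ∣? gcd (a ∸ 1) n ])) (units n))
    ≈⟨ prodₚ-map-∏≤ (λ a d → Φ d ^[ d ∣? gcd (a ∸ 1) n ]) n (units n) ⟩
  ∏[ d ≤ n ] prodₚ (map (λ a → Φ d ^[ d ∣? gcd (a ∸ 1) n ]) (units n))
    ≈⟨ ∏≤-cong n (λ d _ _ → multiplicity-Φ n 1≤n d) ⟩
  ∏[ d ≤ n ] ((Φ d ^ₚ (φ n div φ d)) ^[ d ∣? n ])
    ≈⟨ prodₚ-map-filter (_∣? n) (λ d → Φ d ^ₚ (φ n div φ d)) (range1 n) ⟨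
  prodₚ (map (λ d → Φ d ^ₚ (φ n div φ d)) (filter (_∣? n) (range1 n))) ∎)
  where open SetoidReasoning (CommutativeRing.setoid commutativeRing)
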